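{- Let $\hat G$ be a $3$-edge-coloured complete graph on $k\geq 3$ vertices (colours $\{1,2,3\}$) such that for every colour $c$, every set of $3$ vertices of $\hat G$ strongly $c$-dominates strictly fewer than $2k/3$ vertices. For $n\in\mathbb N$ let $G_n$ be the random $3$-edge-coloured complete graph constructed from $\hat G$ as described in the context. Then for every $\varepsilon>0$, with probability tending to $1$ as $n\to\infty$ the following holds: for every colour $c$ and every good set $S$ for $c$ in $G_n$, the number of vertices of $G_n$ strongly $c$-dominated by $S$ is at most $(2/3+\varepsilon)nk$.
   Context: Strong domination: in an edge-coloured complete graph, a vertex set $A$ strongly $c$-dominates a vertex $b$ if some $a\in A$ has $ab$ coloured $c$. For a vertex $v$ of an edge-coloured complete graph, $A_v$ denotes the set of colours of edges incident to $v$. Construction of $G_n$: $G_n$ is a $3$-edge-coloured complete graph on $nk$ vertices, obtained by replacing each vertex $u$ of $\hat G$ by a class $V_u$ of $n$ vertices; an edge between $V_u$ and $V_v$ ($u\neq v$) receives the colour of $uv$ in $\hat G$, and each edge inside a class $V_u$ is coloured independently and uniformly at random with a colour from $A_u$ (where $A_u$ is computed in $\hat G$). Good set: in a $3$-edge-coloured complete graph, a set of three vertices $\{x,y,z\}$ is a good set for colour $c$ if either (i) at least two of the edges $xy,xz,yz$ have colour $c$, or (ii) one of these edges, say $xy$, has colour $c$ and the remaining vertex $z$ satisfies $|A_z\cup\{c\}|=3$. -}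

module Defs where

open import Data.Nat using (ℕ; zero; suc; _+_; _*_; _≤ᵇ_)
open import Data.Fin using (Fin; zero; suc)
open import Data.Fin.Properties using () renaming (_≟_ to _≟ᶠ_; _<?_ to _<ᶠ?_)
open import Data.Bool using (Bool; true; false; _∧_; _∨_; not; if_then_else_)
open import Data.List using (List; []; _∷_; map; concatMap; allFin)
open import Data.Bool.ListAction using (any; all)
open import Data.Product using (_×_; _,_)
open import Data.Vec.Functional using (Vector) renaming (_∷_ to _∷ᵛ_)
open import Relation.Nullary.Decidable using (⌊_⌋)

Colour : Set
Colour = Fin 3

_==ᶜ_ : Colour → Colour → Bool
a ==ᶜ b = ⌊ a ≟ᶠ b ⌋

countB : {A : Set} → (A → Bool) → List A → ℕ
countB P [] = zero
countB P (x ∷ xs) = if P x then suc (countB P xs) else countB P xs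

allFuns : {A : Set} → (m : ℕ) → List A → List (Fin m → A)
allFuns zero xs = (λ ()) ∷ []
allFuns (suc m) xs = concatMap (λ a → map (λ g → a ∷ᵛ g) (allFuns m xs)) xs

-- A finite edge-coloured complete graph: a list enumerating its vertices
-- (each exactly once), decidable equality, and the colour of each edge
-- (the value on the diagonal is irrelevant).
record CG : Set₁ where
  field
    V     : Set
    verts : List V
    eq?   : V → V → Bool
    col   : V → V → Colour

module _ (G : CG) where
  open CG G

  -- c ∈ A_v : some edge incident to v has colour c
  inA : V → Colour → Bool
  inA v c = any (λ w → not (eq? w v) ∧ (col v w ==ᶜ c)) verts

  sdom : List V → Colour → V → Bool
  sdom A c b = any (λ a → not (eq? a b) ∧ (col a b ==ᶜ c)) A

  domCount : List V → Colour → ℕ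
  domCount A c = countB (sdom A c) verts

  -- | A_z ∪ {c} | = 3
  full : V → Colour → Bool
  full z c = all (λ c' → (c' ==ᶜ c) ∨ inA z c') (allFin 3)

  goodSet : Colour → V → V → V → Bool
  goodSet c x y z =
    ((exy ∧ exz) ∨ (exy ∧ eyz) ∨ (exz ∧ eyz))
    ∨ (exy ∧ full z c) ∨ (exz ∧ full y c) ∨ (eyz ∧ full x c)
    where
    exy = col x y ==ᶜ c
    exz = col x z ==ᶜ c
    eyz = col y z ==ᶜ c

  distinct3 : V → V → V → Bool
  distinct3 x y z = not (eq? x y) ∧ not (eq? x z) ∧ not (eq? y z)

  -- every good set S for every colour c strongly c-dominates
  -- at most (2/3 + p/q) * M vertices, i.e. 3q·|dom| ≤ (2q + 3p)·M
  allGoodBounded : (p q M : ℕ) → Bool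
  allGoodBounded p q M =
    all (λ c → all (λ x → all (λ y → all (λ z →
      not (distinct3 x y z ∧ goodSet c x y z)
      ∨ ((3 * q * domCount (x ∷ y ∷ z ∷ []) c) ≤ᵇ ((2 * q + 3 * p) * M))
    ) verts) verts) verts) (allFin 3)

hatG : (k : ℕ) → (Fin k → Fin k → Colour) → CG
hatG k col = record
  { V = Fin k ; verts = allFin k ; eq? = λ u v → ⌊ u ≟ᶠ v ⌋ ; col = col }

-- Inner colourings: f u i j is the colour of the edge {(u,i),(u,j)} inside
-- class V_u, read only for i < j.
Inner : ℕ → ℕ → Set
Inner k n = Fin k → Fin n → Fin n → Colour

Gn : (k n : ℕ) → (Fin k → Fin k → Colour) → Inner k n → CG
Gn k n col f = record
  { V = Fin k × Fin n
  ; verts = concatMap (λ u → map (λ i → (u , i)) (allFin n)) (allFin k)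
  ; eq? = λ { (u , i) (v , j) → ⌊ u ≟ᶠ v ⌋ ∧ ⌊ i ≟ᶠ j ⌋ }
  ; col = λ { (u , i) (v , j) →
      if ⌊ u ≟ᶠ v ⌋
      then (if ⌊ i <ᶠ? j ⌋ then f u i j else f u j i)
      else col u v }
  }

-- an inner colouring is an outcome of the sample space: for i < j the colour
-- lies in A_u (computed in Ĝ); unused entries (i ≥ j) are fixed to zero.
-- The uniform distribution on these outcomes is exactly the product of
-- independent uniform choices from A_u, one for each edge inside a class.
validInner : (k n : ℕ) → (Fin k → Fin k → Colour) → Inner k n → Bool
validInner k n col f =
  all (λ u → all (λ i → all (λ j →
    if ⌊ i <ᶠ? j ⌋ then inA (hatG k col) u (f u i j) else (f u i j ==ᶜ zero)
  ) (allFin n)) (allFin n)) (allFin k)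

allInner : (k n : ℕ) → List (Inner k n)
allInner k n = allFuns k (allFuns n (allFuns n (allFin 3)))

numOutcomes : (k n : ℕ) → (Fin k → Fin k → Colour) → ℕ
numOutcomes k n col = countB (validInner k n col) (allInner k n)

numGood : (k n : ℕ) → (Fin k → Fin k → Colour) → (p q : ℕ) → ℕ
numGood k n col p q =
  countB (λ f → validInner k n col f
                ∧ allGoodBounded (Gn k n col f) p q (n * k))
         (allInner k n)

-- Project a good set S for colour c of G_n to Ĝ. Its classes lie among three distinct vertices T
-- of Ĝ, and every class except possibly that of one vertex z seeing all three colours is itself
-- c-dominated by T in Ĝ; so S c-dominates at most n · |dom_Ĝ(T)| < 2nk/3 vertices plus the inner
-- c-neighbours of z. Inside a class whose vertex of Ĝ sees all three colours the inner colours are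
-- uniform, so an exponential-moment (Chernoff) bound shows that a given vertex has more than
-- (1/3 + ε) n inner c-neighbours in an exponentially small fraction of the outcomes; a union bound
-- over the 3nk choices of vertex and colour finishes the proof.

module Submission where

open import Defs
open import Data.Nat using (ℕ; zero; suc; _+_; _*_; _∸_; _^_; _≤_; _<_; _≤ᵇ_; z≤n; s≤s; NonZero; >-nonZero)
open import Data.Nat.Properties
open import Data.Nat.Tactic.RingSolver using (solve-∀)
open import Data.Fin using (Fin; zero; suc) renaming (_<_ to _<ᶠ_)
open import Data.Fin.Properties using ()
  renaming (_≟_ to _≟ᶠ_; _<?_ to _<ᶠ?_; <-cmp to <ᶠ-cmp; <-asym to <ᶠ-asym; <-irrefl to <ᶠ-irrefl; <⇒≢ to <⇒≢ᶠ;
            suc-injective to sucᶠ-injective)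
open import Data.Bool using (Bool; true; false; _∧_; _∨_; not; if_then_else_; T)
open import Data.Bool.Properties using (T?; if-float; ∧-assoc; ∧-identityʳ; ∨-commutativeMonoid)
open import Data.Bool.ListAction using (all)
open import Data.List using (List; []; _∷_; map; concatMap; allFin; tabulate; _++_)
open import Data.List.Relation.Unary.All as All using (All; []; _∷_)
open import Data.List.Relation.Unary.All.Properties using (all⁺; all⁻)
open import Data.List.Relation.Unary.Any using (here; there)
open import Data.List.Relation.Unary.Any.Properties using (any⁺; any⁻)
open import Data.List.Membership.Propositional using (_∈_; find; lose)
open import Data.List.Membership.Propositional.Properties using (∈-allFin)
open import Data.Vec.Functional using () renaming (_∷_ to _∷ᵛ_)
open import Data.Product using (_×_; _,_; ∃; ∃-syntax; proj₁; proj₂)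
open import Data.Sum using (_⊎_; inj₁; inj₂; map₂)
open import Data.Empty using (⊥; ⊥-elim)
open import Function using (id; _∘_)
open import Relation.Nullary using (¬_; contradiction; yes; no)
open import Relation.Nullary.Decidable
  using (⌊_⌋; Dec; isYes≗does; ⌊⌋-map′; dec-true; dec-false; toWitness; fromWitness; toWitnessFalse; fromWitnessFalse)
open import Relation.Binary.Definitions using (tri<; tri≈; tri>)
open import Relation.Binary.PropositionalEquality
open import Algebra.Bundles using (CommutativeMonoid)
open import Algebra.Properties.Semiring.Sum +-*-semiring
  using (sum-syntax; sum-cong-≗; ∑-distrib-+; *-distribˡ-sum; sum-replicate-zero)
open import Algebra.Properties.CommutativeMonoid.Sum *-1-commutativeMonoid
  using () renaming (sum to ∏; ∑-distrib-+ to ∏-distrib-*; sum-cong-≗ to ∏-cong)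
open import Algebra.Properties.CommutativeSemigroup +-commutativeSemigroup
  using () renaming (interchange to +-interchange)
open import Algebra.Properties.CommutativeSemigroup (CommutativeMonoid.commutativeSemigroup ∨-commutativeMonoid)
  using () renaming (x∙yz≈y∙xz to ∨-swap)

⟦_⟧ : Bool → ℕ
⟦ true ⟧ = 1
⟦ false ⟧ = 0

T-∨⁻ : ∀ a {b} → T (a ∨ b) → T a ⊎ T b
T-∨⁻ true _ = inj₁ _
T-∨⁻ false t = inj₂ t

T-∧⁻ : ∀ a {b} → T (a ∧ b) → T a × T b
T-∧⁻ true t = _ , t

T-⇒ : ∀ a b → (T a → T b) → T (not a ∨ b)
T-⇒ true b h = h _
T-⇒ false b h = _

T-not : ∀ a → T (not a) → ¬ T a
T-not true () _
T-not false _ ()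

T⇒⟦⟧>0 : ∀ {a} → T a → 0 < ⟦ a ⟧
T⇒⟦⟧>0 {true} _ = s≤s z≤n

T-¬not : ∀ {a} → ¬ T (not a) → T a
T-¬not {true} _ = _
T-¬not {false} h = h _

T-∧⁺ : ∀ {a b} → T a → T b → T (a ∧ b)
T-∧⁺ {true} _ tb = tb

⌊⌋-yes : {A : Set} (a? : Dec A) → A → ⌊ a? ⌋ ≡ true
⌊⌋-yes a? a = trans (isYes≗does a?) (dec-true a? a)

⌊⌋-no : {A : Set} (a? : Dec A) → ¬ A → ⌊ a? ⌋ ≡ false
⌊⌋-no a? ¬a = trans (isYes≗does a?) (dec-false a? ¬a)

⟦∧⟧ : ∀ a b → ⟦ a ∧ b ⟧ ≡ ⟦ a ⟧ * ⟦ b ⟧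
⟦∧⟧ true b = sym (+-identityʳ ⟦ b ⟧)
⟦∧⟧ false b = refl

⟦⟧-≤-+ : ∀ a b c → (T a → T b ⊎ T c) → ⟦ a ⟧ ≤ ⟦ b ⟧ + ⟦ c ⟧
⟦⟧-≤-+ false b c _ = z≤n
⟦⟧-≤-+ true true c _ = s≤s z≤n
⟦⟧-≤-+ true false true _ = s≤s z≤n
⟦⟧-≤-+ true false false h with h _
... | inj₁ ()
... | inj₂ ()

all-intro : {A : Set} (p : A → Bool) (xs : List A) → (∀ x → T (p x)) → T (all p xs)
all-intro p xs h = all⁻ p {xs} (All.tabulate λ {x} _ → h x)

module _ {A : Set} {a b c : A} where
  ∈₁ : a ∈ a ∷ b ∷ c ∷ []
  ∈₁ = here refl
  ∈₂ : b ∈ a ∷ b ∷ c ∷ []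
  ∈₂ = there (here refl)
  ∈₃ : c ∈ a ∷ b ∷ c ∷ []
  ∈₃ = there (there (here refl))

third : ∀ {k} → 3 ≤ k → (a b : Fin k) → ∃[ t ] (t ≢ a × t ≢ b)
third {suc zero} (s≤s ()) a b
third {suc (suc zero)} (s≤s (s≤s ())) a b
third {suc (suc (suc _))} _ a b with zero ≟ᶠ a | zero ≟ᶠ b
... | no 0≢a | no 0≢b = zero , 0≢a , 0≢b
... | yes refl | _ with suc zero ≟ᶠ b
...   | no 1≢b = suc zero , (λ ()) , 1≢b
...   | yes refl = suc (suc zero) , (λ ()) , (λ ())
third {suc (suc (suc _))} _ a b | no _ | yes refl with suc zero ≟ᶠ a
...   | no 1≢a = suc zero , 1≢a , (λ ())
...   | yes refl = suc (suc zero) , (λ ()) , (λ ())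

module _ {m : ℕ} (i j : Fin m) where

  ⟦<⟧+⟦>⟧ : (a b : Bool) →
            ⟦ ⌊ i <ᶠ? j ⌋ ∧ a ⟧ + ⟦ ⌊ j <ᶠ? i ⌋ ∧ b ⟧ ≡ ⟦ not ⌊ i ≟ᶠ j ⌋ ∧ (if ⌊ i <ᶠ? j ⌋ then a else b) ⟧
  ⟦<⟧+⟦>⟧ a b with <ᶠ-cmp i j
  ... | tri< i<j _ _
    rewrite ⌊⌋-yes (i <ᶠ? j) i<j | ⌊⌋-no (j <ᶠ? i) (<ᶠ-asym i<j) | ⌊⌋-no (i ≟ᶠ j) (<⇒≢ᶠ i<j) = +-identityʳ _
  ... | tri≈ i≮j i≡j _
    rewrite ⌊⌋-no (i <ᶠ? j) i≮j | ⌊⌋-no (j <ᶠ? i) (<ᶠ-irrefl (sym i≡j)) | ⌊⌋-yes (i ≟ᶠ j) i≡j = refl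
  ... | tri> _ _ j<i
    rewrite ⌊⌋-no (i <ᶠ? j) (<ᶠ-asym j<i) | ⌊⌋-yes (j <ᶠ? i) j<i | ⌊⌋-no (i ≟ᶠ j) (<⇒≢ᶠ j<i ∘ sym) = refl

  ⟦<⟧+⟦>⟧+⟦≡⟧ : ⟦ ⌊ i <ᶠ? j ⌋ ⟧ + ⟦ ⌊ j <ᶠ? i ⌋ ⟧ + ⟦ ⌊ j ≟ᶠ i ⌋ ⟧ ≡ 1
  ⟦<⟧+⟦>⟧+⟦≡⟧ with <ᶠ-cmp i j
  ... | tri< i<j _ _
    rewrite ⌊⌋-yes (i <ᶠ? j) i<j | ⌊⌋-no (j <ᶠ? i) (<ᶠ-asym i<j) | ⌊⌋-no (j ≟ᶠ i) (<⇒≢ᶠ i<j ∘ sym) = refl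
  ... | tri≈ i≮j i≡j _
    rewrite ⌊⌋-no (i <ᶠ? j) i≮j | ⌊⌋-no (j <ᶠ? i) (<ᶠ-irrefl (sym i≡j)) | ⌊⌋-yes (j ≟ᶠ i) (sym i≡j) = refl
  ... | tri> _ _ j<i
    rewrite ⌊⌋-no (i <ᶠ? j) (<ᶠ-asym j<i) | ⌊⌋-yes (j <ᶠ? i) j<i | ⌊⌋-no (j ≟ᶠ i) (<⇒≢ᶠ j<i) = refl

∑-mono-≤ : ∀ {m} {g h : Fin m → ℕ} → (∀ t → g t ≤ h t) → ∑[ t < m ] g t ≤ ∑[ t < m ] h t
∑-mono-≤ {zero} le = z≤n
∑-mono-≤ {suc m} le = +-mono-≤ (le zero) (∑-mono-≤ (le ∘ suc))

∑-const : ∀ m a → ∑[ t < m ] a ≡ m * a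
∑-const zero a = refl
∑-const (suc m) a = cong (a +_) (∑-const m a)

≤-∑ : ∀ {m} (g : Fin m → ℕ) t → g t ≤ ∑[ s < m ] g s
≤-∑ g zero = m≤m+n _ _
≤-∑ g (suc t) = ≤-trans (≤-∑ (g ∘ suc) t) (m≤n+m _ _)

∑-indicator : ∀ {m} (u : Fin m) (g : Fin m → ℕ) → ∑[ v < m ] (⟦ ⌊ v ≟ᶠ u ⌋ ⟧ * g v) ≡ g u
∑-indicator {suc m} zero g = trans (cong₂ _+_ (+-identityʳ (g zero)) (sum-replicate-zero m)) (+-identityʳ (g zero))
∑-indicator {suc m} (suc u) g =
  trans (sum-cong-≗ (λ v → cong (λ b → ⟦ b ⟧ * g (suc v)) (⌊⌋-map′ (cong suc) sucᶠ-injective (v ≟ᶠ u)))) (∑-indicator u (g ∘ suc))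

∏-pow : ∀ {m} (X : ℕ) (e : Fin m → ℕ) → ∏ (λ t → X ^ e t) ≡ X ^ ∑[ t < m ] e t
∏-pow {zero} X e = refl
∏-pow {suc m} X e = trans (cong (X ^ e zero *_) (∏-pow X (e ∘ suc))) (sym (^-distribˡ-+-* X (e zero) _))

⟦all⟧ : {A : Set} {m : ℕ} (p : A → Bool) (g : Fin m → A) → ⟦ all p (tabulate g) ⟧ ≡ ∏ (λ t → ⟦ p (g t) ⟧)
⟦all⟧ {m = zero} p g = refl
⟦all⟧ {m = suc m} p g with p (g zero)
... | true = trans (⟦all⟧ p (g ∘ suc)) (sym (+-identityʳ _))
... | false = refl

sumOver : {A : Set} → (A → ℕ) → List A → ℕ
sumOver h [] = 0
sumOver h (x ∷ xs) = h x + sumOver h xs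

module _ {A : Set} where

  countB≡sumOver : (P : A → Bool) (xs : List A) → countB P xs ≡ sumOver (⟦_⟧ ∘ P) xs
  countB≡sumOver P [] = refl
  countB≡sumOver P (x ∷ xs) with P x
  ... | true = cong suc (countB≡sumOver P xs)
  ... | false = countB≡sumOver P xs

  sumOver-cong : {g h : A → ℕ} (xs : List A) → (∀ x → g x ≡ h x) → sumOver g xs ≡ sumOver h xs
  sumOver-cong [] e = refl
  sumOver-cong (x ∷ xs) e = cong₂ _+_ (e x) (sumOver-cong xs e)

  sumOver-mono : {g h : A → ℕ} (xs : List A) → (∀ x → g x ≤ h x) → sumOver g xs ≤ sumOver h xs
  sumOver-mono [] le = z≤n
  sumOver-mono (x ∷ xs) le = +-mono-≤ (le x) (sumOver-mono xs le)

  sumOver-+ : (g h : A → ℕ) (xs : List A) → sumOver (λ x → g x + h x) xs ≡ sumOver g xs + sumOver h xs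
  sumOver-+ g h [] = refl
  sumOver-+ g h (x ∷ xs) = trans (cong (g x + h x +_) (sumOver-+ g h xs)) (+-interchange (g x) (h x) _ _)

  sumOver-*ˡ : (a : ℕ) (h : A → ℕ) (xs : List A) → sumOver (λ x → a * h x) xs ≡ a * sumOver h xs
  sumOver-*ˡ a h [] = sym (*-zeroʳ a)
  sumOver-*ˡ a h (x ∷ xs) = trans (cong (a * h x +_) (sumOver-*ˡ a h xs)) (sym (*-distribˡ-+ a (h x) _))

  sumOver-*ʳ : (a : ℕ) (h : A → ℕ) (xs : List A) → sumOver (λ x → h x * a) xs ≡ sumOver h xs * a
  sumOver-*ʳ a h [] = refl
  sumOver-*ʳ a h (x ∷ xs) = trans (cong (h x * a +_) (sumOver-*ʳ a h xs)) (sym (*-distribʳ-+ a (h x) _))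

  sumOver-∑ : {m : ℕ} (g : A → Fin m → ℕ) (xs : List A) →
              sumOver (λ x → ∑[ t < m ] g x t) xs ≡ ∑[ t < m ] sumOver (λ x → g x t) xs
  sumOver-∑ {m} g [] = sym (sum-replicate-zero m)
  sumOver-∑ g (x ∷ xs) = trans (cong (_ +_) (sumOver-∑ g xs)) (sym (∑-distrib-+ (g x) _))

  sumOver-++ : (h : A → ℕ) (xs ys : List A) → sumOver h (xs ++ ys) ≡ sumOver h xs + sumOver h ys
  sumOver-++ h [] ys = refl
  sumOver-++ h (x ∷ xs) ys = trans (cong (h x +_) (sumOver-++ h xs ys)) (sym (+-assoc (h x) _ _))

  sumOver-tabulate : {m : ℕ} (h : A → ℕ) (g : Fin m → A) → sumOver h (tabulate g) ≡ ∑[ t < m ] h (g t)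
  sumOver-tabulate {zero} h g = refl
  sumOver-tabulate {suc m} h g = cong (h (g zero) +_) (sumOver-tabulate h (g ∘ suc))

module _ {A B : Set} where

  sumOver-map : (h : B → ℕ) (F : A → B) (xs : List A) → sumOver h (map F xs) ≡ sumOver (h ∘ F) xs
  sumOver-map h F [] = refl
  sumOver-map h F (x ∷ xs) = cong (h (F x) +_) (sumOver-map h F xs)

  sumOver-concatMap : (h : B → ℕ) (F : A → List B) (xs : List A) →
                      sumOver h (concatMap F xs) ≡ sumOver (λ x → sumOver h (F x)) xs
  sumOver-concatMap h F [] = refl
  sumOver-concatMap h F (x ∷ xs) =
    trans (sumOver-++ h (F x) (concatMap F xs)) (cong (sumOver h (F x) +_) (sumOver-concatMap h F xs))

sumOver-allFuns : {A : Set} (m : ℕ) (xs : List A) (φ : Fin m → A → ℕ) →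
                  sumOver (λ g → ∏ (λ t → φ t (g t))) (allFuns m xs) ≡ ∏ (λ t → sumOver (φ t) xs)
sumOver-allFuns zero xs φ = refl
sumOver-allFuns {A} (suc m) xs φ = begin
  sumOver weight (concatMap (λ a → map (a ∷ᵛ_) (allFuns m xs)) xs)
    ≡⟨ sumOver-concatMap weight _ xs ⟩
  sumOver (λ a → sumOver weight (map (a ∷ᵛ_) (allFuns m xs))) xs
    ≡⟨ sumOver-cong xs (λ a → trans (sumOver-map weight (a ∷ᵛ_) (allFuns m xs))
                                    (sumOver-*ˡ (φ zero a) (λ g → ∏ (λ t → φ (suc t) (g t))) (allFuns m xs))) ⟩
  sumOver (λ a → φ zero a * sumOver (λ g → ∏ (λ t → φ (suc t) (g t))) (allFuns m xs)) xs
    ≡⟨ sumOver-cong xs (λ a → cong (φ zero a *_) (sumOver-allFuns m xs (φ ∘ suc))) ⟩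
  sumOver (λ a → φ zero a * ∏ (λ t → sumOver (φ (suc t)) xs)) xs
    ≡⟨ sumOver-*ʳ _ (φ zero) xs ⟩
  sumOver (φ zero) xs * ∏ (λ t → sumOver (φ (suc t)) xs) ∎
  where
  open ≡-Reasoning
  weight : (Fin (suc m) → A) → ℕ
  weight g = ∏ (λ t → φ t (g t))

countB-*-≤-sumOver : {A : Set} (P : A → Bool) (a : ℕ) (g : A → ℕ) (xs : List A) →
                     (∀ x → T (P x) → a ≤ g x) → countB P xs * a ≤ sumOver g xs
countB-*-≤-sumOver P a g [] h = z≤n
countB-*-≤-sumOver P a g (x ∷ xs) h with P x in Px
... | true = +-mono-≤ (h x (subst T (sym Px) _)) (countB-*-≤-sumOver P a g xs h)
... | false = ≤-trans (countB-*-≤-sumOver P a g xs h) (m≤n+m _ _)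

countB-none : {A : Set} (P : A → Bool) (xs : List A) → (∀ x → ¬ T (P x)) → countB P xs ≡ 0
countB-none P [] _ = refl
countB-none P (x ∷ xs) none with P x in Px
... | true = ⊥-elim (none x (subst T (sym Px) _))
... | false = countB-none P xs none

countB-cong : {A : Set} {P Q : A → Bool} (xs : List A) → (∀ x → P x ≡ Q x) → countB P xs ≡ countB Q xs
countB-cong {P = P} {Q} xs P≗Q =
  trans (countB≡sumOver P xs) (trans (sumOver-cong xs (cong ⟦_⟧ ∘ P≗Q)) (sym (countB≡sumOver Q xs)))

-- Bernoulli's inequality (1 + 1/Q)^j ≥ 1 + j/Q, multiplied by Q^(j+1).
bernoulli : ∀ Q j → Q ^ suc j + j * Q ^ j ≤ Q * suc Q ^ j
bernoulli Q zero = ≤-reflexive (+-identityʳ _)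
bernoulli Q (suc j) = begin
  Q ^ suc (suc j) + suc j * Q ^ suc j                ≤⟨ m≤m+n _ (j * Q ^ j) ⟩
  Q ^ suc (suc j) + suc j * Q ^ suc j + j * Q ^ j    ≡⟨ expand Q j (Q ^ j) ⟩
  suc Q * (Q ^ suc j + j * Q ^ j)                    ≤⟨ *-monoʳ-≤ (suc Q) (bernoulli Q j) ⟩
  suc Q * (Q * suc Q ^ j)                            ≡⟨ x*[y*z]≡y*[x*z] (suc Q) Q _ ⟩
  Q * suc Q ^ suc j                                  ∎
  where
  open ≤-Reasoning
  expand : ∀ Q j x → Q * (Q * x) + suc j * (Q * x) + j * x ≡ suc Q * (Q * x + j * x)
  expand = solve-∀
  x*[y*z]≡y*[x*z] : ∀ x y z → x * (y * z) ≡ y * (x * z)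
  x*[y*z]≡y*[x*z] = solve-∀

j*Q^j≤Q*[1+Q]^j : ∀ Q j → j * Q ^ j ≤ Q * suc Q ^ j
j*Q^j≤Q*[1+Q]^j Q j = ≤-trans (m≤n+m _ _) (bernoulli Q j)

-- Polynomial times Q^m is eventually dominated by (Q+1)^m: write m = j₀ + b with both
-- parts large and apply the previous bound to j₀ and to b separately.
C*[1+m]*Q^m≤[1+Q]^m-eventually : ∀ Q C → 1 ≤ Q → ∃ λ N → ∀ m → N ≤ m → C * suc m * Q ^ m ≤ suc Q ^ m
C*[1+m]*Q^m≤[1+Q]^m-eventually Q C 1≤Q = j₀ + suc j₀ , bound
  where
  j₀ : ℕ
  j₀ = suc (2 * (Q * Q * C))
  bound : ∀ m → j₀ + suc j₀ ≤ m → C * suc m * Q ^ m ≤ suc Q ^ m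
  bound m le with b , refl ← m≤n⇒∃[o]m+o≡n (≤-trans (m≤m+n j₀ _) le) =
    *-cancelʳ-≤ _ _ (Q * Q) {{>-nonZero (*-mono-≤ 1≤Q 1≤Q)}} (begin
      C * suc (j₀ + b) * Q ^ (j₀ + b) * (Q * Q)     ≡⟨ regroup C (suc (j₀ + b)) (Q ^ (j₀ + b)) Q ⟩
      Q * Q * C * suc (j₀ + b) * Q ^ (j₀ + b)       ≤⟨ *-monoˡ-≤ (Q ^ (j₀ + b)) (linear≤j₀*b b (+-cancelˡ-≤ j₀ _ _ le)) ⟩
      j₀ * b * Q ^ (j₀ + b)                         ≡⟨ split ⟩
      (j₀ * Q ^ j₀) * (b * Q ^ b)                   ≤⟨ *-mono-≤ (j*Q^j≤Q*[1+Q]^j Q j₀) (j*Q^j≤Q*[1+Q]^j Q b) ⟩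
      (Q * suc Q ^ j₀) * (Q * suc Q ^ b)            ≡⟨ join ⟩
      suc Q ^ (j₀ + b) * (Q * Q)                    ∎)
    where
    open ≤-Reasoning
    regroup : ∀ C s x Q → C * s * x * (Q * Q) ≡ Q * Q * C * s * x
    regroup = solve-∀
    split : j₀ * b * Q ^ (j₀ + b) ≡ (j₀ * Q ^ j₀) * (b * Q ^ b)
    split = trans (cong (j₀ * b *_) (^-distribˡ-+-* Q j₀ b)) (swap j₀ b (Q ^ j₀) (Q ^ b))
      where
      swap : ∀ a b x y → a * b * (x * y) ≡ (a * x) * (b * y)
      swap = solve-∀
    join : (Q * suc Q ^ j₀) * (Q * suc Q ^ b) ≡ suc Q ^ (j₀ + b) * (Q * Q)
    join = trans (swap Q (suc Q ^ j₀) (suc Q ^ b)) (cong (_* (Q * Q)) (sym (^-distribˡ-+-* (suc Q) j₀ b)))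
      where
      swap : ∀ Q x y → (Q * x) * (Q * y) ≡ (x * y) * (Q * Q)
      swap = solve-∀
    linear≤j₀*b : ∀ b → suc j₀ ≤ b → Q * Q * C * suc (j₀ + b) ≤ j₀ * b
    linear≤j₀*b b le with t , refl ← m≤n⇒∃[o]m+o≡n le =
      subst (L * suc (j₀ + (suc j₀ + t)) ≤_) (sym (expand L t)) (m≤m+n _ _)
      where
      L : ℕ
      L = Q * Q * C
      expand : ∀ L t → suc (2 * L) * (suc (suc (2 * L)) + t)
                       ≡ L * suc (suc (2 * L) + (suc (suc (2 * L)) + t)) + (2 * L + 2 + L * t + t)
      expand = solve-∀

[1+L]^N*M≤L^[1+N] : ∀ L N M → N + M ≤ L → suc L ^ N * M ≤ L ^ suc N
[1+L]^N*M≤L^[1+N] L zero M le = ≤-trans (≤-reflexive (+-identityʳ M)) (≤-trans le (≤-reflexive (sym (*-identityʳ L))))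
[1+L]^N*M≤L^[1+N] L (suc N) M le = begin
  suc L ^ suc N * M          ≡⟨ regroup (suc L) (suc L ^ N) M ⟩
  suc L ^ N * (suc L * M)    ≤⟨ *-monoʳ-≤ (suc L ^ N) [1+L]*M≤L*[1+M] ⟩
  suc L ^ N * (L * suc M)    ≡⟨ x*[y*z]≡y*[x*z] (suc L ^ N) L (suc M) ⟩
  L * (suc L ^ N * suc M)    ≤⟨ *-monoʳ-≤ L ([1+L]^N*M≤L^[1+N] L N (suc M) (≤-trans (≤-reflexive (+-suc N M)) le)) ⟩
  L * L ^ suc N              ∎
  where
  open ≤-Reasoning
  regroup : ∀ a x y → a * x * y ≡ x * (a * y)
  regroup = solve-∀
  x*[y*z]≡y*[x*z] : ∀ x y z → x * (y * z) ≡ y * (x * z)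
  x*[y*z]≡y*[x*z] = solve-∀
  [1+L]*M≤L*[1+M] : suc L * M ≤ L * suc M
  [1+L]*M≤L*[1+M] = subst (M + L * M ≤_) (sym (*-suc L M)) (+-monoˡ-≤ (L * M) (≤-trans (m≤n+m M (suc N)) le))

chernoffBase : ℕ → ℕ
chernoffBase q′ = 3 * suc q′ + (3 * suc q′ * suc q′ + 1)

-- The Chernoff step: with weights (L+1)^(3q) on one colour and L^(3q) on the other two, the
-- mean weight is below (L+1)^(q+1) L^(2q-1), the weight per edge of an edge set in which the
-- first colour has frequency (q+1)/(3q).
chernoff-weights : ∀ q′ → let q = suc q′ ; L = chernoffBase q′ in
                   suc L ^ (3 * q) + 2 * L ^ (3 * q) < 3 * (suc L ^ suc q * L ^ (q + q′))
chernoff-weights q′ = *-cancelˡ-< (L * M) X Y (begin-strict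
    L * M * X                                ≡⟨ distrib L M (suc L ^ N) x ⟩
    L * (suc L ^ N * M) + 2 * L * M * x      ≤⟨ +-monoˡ-≤ _ (*-monoʳ-≤ L ([1+L]^N*M≤L^[1+N] L N M ≤-refl)) ⟩
    L * (L * x) + 2 * L * M * x              ≡⟨ collect L M x ⟩
    x * (L * L + 2 * L * M)                  <⟨ *-monoʳ-< x (m<m+n _ (s≤s z≤n)) ⟩
    x * (L * L + 2 * L * M + 3)              ≡⟨ cong (x *_) (quadratic q′) ⟩
    x * (3 * M * (L + suc q))                ≡⟨ powers ⟩
    3 * M * L ^ (q + q′) * (L ^ suc (suc q) + suc q * L ^ suc q)
                                             ≤⟨ *-monoʳ-≤ (3 * M * L ^ (q + q′)) (bernoulli L (suc q)) ⟩
    3 * M * L ^ (q + q′) * (L * suc L ^ suc q) ≡⟨ rearrange M (L ^ (q + q′)) L (suc L ^ suc q) ⟩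
    L * M * Y                                ∎)
  where
  open ≤-Reasoning
  q N M L x X Y : ℕ
  q = suc q′
  N = 3 * q
  M = 3 * q * q + 1
  L = chernoffBase q′
  x = L ^ N
  X = suc L ^ N + 2 * L ^ N
  Y = 3 * (suc L ^ suc q * L ^ (q + q′))
  instance
    x-nonZero : NonZero x
    x-nonZero = m^n≢0 L N
  distrib : ∀ L M y x → L * M * (y + 2 * x) ≡ L * (y * M) + 2 * L * M * x
  distrib = solve-∀
  collect : ∀ L M x → L * (L * x) + 2 * L * M * x ≡ x * (L * L + 2 * L * M)
  collect = solve-∀
  quadratic : ∀ q′ → let q = suc q′ ; M = 3 * q * q + 1 ; L = 3 * q + M in L * L + 2 * L * M + 3 ≡ 3 * M * (L + suc q)
  quadratic = solve-∀
  powers : x * (3 * M * (L + suc q)) ≡ 3 * M * L ^ (q + q′) * (L ^ suc (suc q) + suc q * L ^ suc q)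
  powers = begin-equality
    x * (3 * M * (L + suc q))                                     ≡⟨ cong (_* (3 * M * (L + suc q))) split ⟩
    L ^ (q + q′) * L ^ suc q * (3 * M * (L + suc q))               ≡⟨ expand M (L ^ (q + q′)) (L ^ suc q) L (suc q) ⟩
    3 * M * L ^ (q + q′) * (L ^ suc (suc q) + suc q * L ^ suc q)   ∎
    where
    split : x ≡ L ^ (q + q′) * L ^ suc q
    split = trans (cong (L ^_) (exponents q′)) (^-distribˡ-+-* L (q + q′) (suc q))
      where
      exponents : ∀ q′ → 3 * suc q′ ≡ suc q′ + q′ + suc (suc q′)
      exponents = solve-∀
    expand : ∀ M a b L s → a * b * (3 * M * (L + s)) ≡ 3 * M * a * (L * b + s * b)
    expand = solve-∀
  rearrange : ∀ M a L b → 3 * M * a * (L * b) ≡ L * M * (3 * (b * a))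
  rearrange = solve-∀

pow-shift : ∀ {a b} e₁ e₂ E₁ E₂ → b ≤ a → e₁ ≤ E₁ → E₁ + E₂ ≡ e₁ + e₂ → a ^ e₁ * b ^ e₂ ≤ a ^ E₁ * b ^ E₂
pow-shift {a} {b} e₁ e₂ E₁ E₂ b≤a e₁≤E₁ same with δ , refl ← m≤n⇒∃[o]m+o≡n e₁≤E₁ = begin
  a ^ e₁ * b ^ e₂                ≡⟨ cong (λ e → a ^ e₁ * b ^ e) e₂≡δ+E₂ ⟩
  a ^ e₁ * b ^ (δ + E₂)          ≡⟨ cong (a ^ e₁ *_) (^-distribˡ-+-* b δ E₂) ⟩
  a ^ e₁ * (b ^ δ * b ^ E₂)      ≤⟨ *-monoʳ-≤ (a ^ e₁) (*-monoˡ-≤ (b ^ E₂) (^-monoˡ-≤ δ b≤a)) ⟩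
  a ^ e₁ * (a ^ δ * b ^ E₂)      ≡⟨ sym (*-assoc (a ^ e₁) _ _) ⟩
  a ^ e₁ * a ^ δ * b ^ E₂        ≡⟨ cong (_* b ^ E₂) (sym (^-distribˡ-+-* a e₁ δ)) ⟩
  a ^ (e₁ + δ) * b ^ E₂          ∎
  where
  open ≤-Reasoning
  e₂≡δ+E₂ : e₂ ≡ δ + E₂
  e₂≡δ+E₂ = +-cancelˡ-≡ e₁ e₂ (δ + E₂) (trans (sym same) (+-assoc e₁ δ E₂))

^-distribʳ-* : ∀ a b m → (a * b) ^ m ≡ a ^ m * b ^ m
^-distribʳ-* a b zero = refl
^-distribʳ-* a b (suc m) = trans (cong (a * b *_) (^-distribʳ-* a b m)) (swap a b (a ^ m) (b ^ m))
  where
  swap : ∀ a b x y → a * b * (x * y) ≡ a * x * (b * y)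
  swap = solve-∀

-- (1/3 + ε) n of excess on top of n times fewer than 2k/3 stays below (2/3 + ε) n k.
blowup-arithmetic : ∀ p q n k {dom D X} → dom ≤ n * D + X → 3 * D < 2 * k → 3 * q * X ≤ (q + 3 * p) * n →
                    3 * q * dom ≤ (2 * q + 3 * p) * (n * k)
blowup-arithmetic p q n k {dom} {D} {X} dom≤ 3D<2k X-small = begin
  3 * q * dom                              ≤⟨ *-monoʳ-≤ (3 * q) dom≤ ⟩
  3 * q * (n * D + X)                      ≡⟨ expand q n D X ⟩
  q * n * (3 * D) + 3 * q * X              ≤⟨ +-monoʳ-≤ (q * n * (3 * D)) X-small ⟩
  q * n * (3 * D) + (q + 3 * p) * n        ≡⟨ regroup q n D p ⟩
  q * n * suc (3 * D) + 3 * p * (n * 1)    ≤⟨ +-mono-≤ (*-monoʳ-≤ (q * n) 3D<2k) (*-monoʳ-≤ (3 * p) (*-monoʳ-≤ n k≥1)) ⟩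
  q * n * (2 * k) + 3 * p * (n * k)        ≡⟨ collect q n k p ⟩
  (2 * q + 3 * p) * (n * k)                ∎
  where
  open ≤-Reasoning
  k≥1 : 1 ≤ k
  k≥1 = n≢0⇒n>0 λ { refl → n≮0 3D<2k }
  expand : ∀ q n D X → 3 * q * (n * D + X) ≡ q * n * (3 * D) + 3 * q * X
  expand = solve-∀
  regroup : ∀ q n D p → q * n * (3 * D) + (q + 3 * p) * n ≡ q * n * suc (3 * D) + 3 * p * (n * 1)
  regroup = solve-∀
  collect : ∀ q n k p → q * n * (2 * k) + 3 * p * (n * k) ≡ (2 * q + 3 * p) * (n * k)
  collect = solve-∀

-- The base graph Ĝ and its blow-up G_n

-- Definitionally the predicate that  sdom  tests on each dominator.
joined : (H : CG) → Colour → CG.V H → CG.V H → Bool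
joined H c a b = not (CG.eq? H a b) ∧ (CG.col H a b ==ᶜ c)

module BaseGraph (k : ℕ) (col : Fin k → Fin k → Colour) where

  Ĝ : CG
  Ĝ = hatG k col

  fullĜ : Fin k → Bool
  fullĜ u = all (inA Ĝ u) (allFin 3)

  TriplesDominateFew : Set
  TriplesDominateFew = ∀ c (x y z : Fin k) → x ≢ y → x ≢ z → y ≢ z → 3 * domCount Ĝ (x ∷ y ∷ z ∷ []) c < 2 * k

  joinedĜ : ∀ {s v c} → s ≢ v → col s v ≡ c → T (joined Ĝ c s v)
  joinedĜ {s} {v} {c} s≢v e =
    T-∧⁺ (fromWitnessFalse {a? = s ≟ᶠ v} s≢v) (fromWitness {a? = col s v ≟ᶠ c} e)

  dominatedĜ : ∀ {Tl s v c} → s ∈ Tl → s ≢ v → col s v ≡ c → T (sdom Ĝ Tl c v)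
  dominatedĜ s∈Tl s≢v e = any⁺ _ (lose s∈Tl (joinedĜ s≢v e))

  inAĜ-intro : ∀ {u t c} → t ≢ u → col u t ≡ c → T (inA Ĝ u c)
  inAĜ-intro {u} {t} {c} t≢u e =
    any⁺ _ (lose (∈-allFin t) (T-∧⁺ (fromWitnessFalse {a? = t ≟ᶠ u} t≢u) (fromWitness {a? = col u t ≟ᶠ c} e)))

  inAĜ-elim : ∀ {u c} → T (inA Ĝ u c) → ∃[ t ] (t ≢ u × col u t ≡ c)
  inAĜ-elim {u} {c} e with t , _ , e′ ← find (any⁻ (λ t → not ⌊ t ≟ᶠ u ⌋ ∧ (col u t ==ᶜ c)) (allFin k) e)
    with t≢u , ut≡c ← T-∧⁻ (not ⌊ t ≟ᶠ u ⌋) e′ = t , toWitnessFalse t≢u , toWitness ut≡c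

good-shape : ∀ exy exz eyz fx fy fz →
  T (((exy ∧ exz) ∨ (exy ∧ eyz) ∨ (exz ∧ eyz)) ∨ (exy ∧ fz) ∨ (exz ∧ fy) ∨ (eyz ∧ fx)) →
  T exy × T exz ⊎ T exy × T eyz ⊎ T exz × T eyz ⊎ T exy × T fz ⊎ T exz × T fy ⊎ T eyz × T fx
good-shape exy exz eyz fx fy fz good with T-∨⁻ ((exy ∧ exz) ∨ (exy ∧ eyz) ∨ (exz ∧ eyz)) good
... | inj₁ two with T-∨⁻ (exy ∧ exz) two
...   | inj₁ xy,xz = inj₁ (T-∧⁻ exy xy,xz)
...   | inj₂ rest with T-∨⁻ (exy ∧ eyz) rest
...     | inj₁ xy,yz = inj₂ (inj₁ (T-∧⁻ exy xy,yz))
...     | inj₂ xz,yz = inj₂ (inj₂ (inj₁ (T-∧⁻ exz xz,yz)))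
good-shape exy exz eyz fx fy fz good | inj₂ one with T-∨⁻ (exy ∧ fz) one
... | inj₁ xy,z = inj₂ (inj₂ (inj₂ (inj₁ (T-∧⁻ exy xy,z))))
... | inj₂ rest with T-∨⁻ (exz ∧ fy) rest
...   | inj₁ xz,y = inj₂ (inj₂ (inj₂ (inj₂ (inj₁ (T-∧⁻ exz xz,y)))))
...   | inj₂ yz,x = inj₂ (inj₂ (inj₂ (inj₂ (inj₂ (T-∧⁻ eyz yz,x)))))

module Blowup (k n : ℕ) (col : Fin k → Fin k → Colour) (f : Inner k n) where

  open BaseGraph k col public

  G : CG
  G = Gn k n col f

  innerCol : Fin k → Fin n → Fin n → Colour
  innerCol u i j = if ⌊ i <ᶠ? j ⌋ then f u i j else f u j i

  innerNbr : Fin k → Fin n → Colour → Fin n → Bool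
  innerNbr u i c j = not ⌊ i ≟ᶠ j ⌋ ∧ (innerCol u i j ==ᶜ c)

  innerDeg : Fin k → Fin n → Colour → ℕ
  innerDeg u i c = ∑[ j < n ] ⟦ innerNbr u i c j ⟧

  innerDeg-split : ∀ u i c → innerDeg u i c ≡
    ∑[ j < n ] ⟦ ⌊ i <ᶠ? j ⌋ ∧ (f u i j ==ᶜ c) ⟧ + ∑[ j < n ] ⟦ ⌊ j <ᶠ? i ⌋ ∧ (f u j i ==ᶜ c) ⟧
  innerDeg-split u i c = sym (trans (sym (∑-distrib-+ out in′))
    (sum-cong-≗ λ j → trans (⟦<⟧+⟦>⟧ i j _ _) (cong (λ b → ⟦ not ⌊ i ≟ᶠ j ⌋ ∧ b ⟧) (sym (if-float (_==ᶜ c) ⌊ i <ᶠ? j ⌋)))))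
    where
    out in′ : Fin n → ℕ
    out j = ⟦ ⌊ i <ᶠ? j ⌋ ∧ (f u i j ==ᶜ c) ⟧
    in′ j = ⟦ ⌊ j <ᶠ? i ⌋ ∧ (f u j i ==ᶜ c) ⟧

  innerCol-< : ∀ u {i j} → i <ᶠ j → innerCol u i j ≡ f u i j
  innerCol-< u {i} {j} i<j = cong (λ b → if b then f u i j else f u j i) (⌊⌋-yes (i <ᶠ? j) i<j)

  innerCol-> : ∀ u {i j} → j <ᶠ i → innerCol u i j ≡ f u j i
  innerCol-> u {i} {j} j<i = cong (λ b → if b then f u i j else f u j i) (⌊⌋-no (i <ᶠ? j) (<ᶠ-asym j<i))

  innerCol-comm : ∀ u {i j} → i ≢ j → innerCol u i j ≡ innerCol u j i
  innerCol-comm u {i} {j} i≢j with <ᶠ-cmp i j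
  ... | tri< i<j _ _ = trans (innerCol-< u i<j) (sym (innerCol-> u i<j))
  ... | tri≈ _ i≡j _ = contradiction i≡j i≢j
  ... | tri> _ _ j<i = trans (innerCol-> u j<i) (sym (innerCol-< u j<i))

  G-≢ : ∀ {u i v j} → T (not (CG.eq? G (u , i) (v , j))) → u ≡ v → i ≢ j
  G-≢ {u} {i} ne refl refl = subst (T ∘ not) (cong₂ _∧_ (⌊⌋-yes (u ≟ᶠ u) refl) (⌊⌋-yes (i ≟ᶠ i) refl)) ne

  joinedG : ∀ {u i v j c} → T (joined G c (u , i) (v , j)) →
            (u ≢ v × col u v ≡ c) ⊎ (u ≡ v × T (innerNbr v i c j))
  joinedG {u} {i} {v} {j} {c} e with u ≟ᶠ v
  ... | yes refl = inj₂ (refl , e)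
  ... | no u≢v = inj₁ (u≢v , toWitness e)

  joined-across : ∀ {u i v j c} → T (joined G c (u , i) (v , j)) → u ≢ v → col u v ≡ c
  joined-across {u} {i} {v} {j} {c} e u≢v with joinedG {u} {i} {v} {j} {c} e
  ... | inj₁ (_ , uv≡c) = uv≡c
  ... | inj₂ (u≡v , _) = contradiction u≡v u≢v

  joinedG-across : ∀ {u i v j c} → u ≢ v → col u v ≡ c → T (joined G c (u , i) (v , j))
  joinedG-across {u} {i} {v} {j} {c} u≢v e =
    subst (λ b → T (not (b ∧ ⌊ i ≟ᶠ j ⌋) ∧ ((if b then innerCol u i j else col u v) ==ᶜ c)))
      (sym (⌊⌋-no (u ≟ᶠ v) u≢v)) (fromWitness {a? = col u v ≟ᶠ c} e)

  joinedG-within : ∀ {u i j c} → T (innerNbr u i c j) → T (joined G c (u , i) (u , j))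
  joinedG-within {u} {i} {j} {c} nbr =
    subst (λ b → T (not (b ∧ ⌊ i ≟ᶠ j ⌋) ∧ ((if b then innerCol u i j else col u u) ==ᶜ c)))
      (sym (⌊⌋-yes (u ≟ᶠ u) refl)) nbr

  joined-comm : (∀ u v → col u v ≡ col v u) → ∀ {a b c} → T (joined G c a b) → T (joined G c b a)
  joined-comm col-comm {u , i} {v , j} {c} ab with joinedG ab
  ... | inj₁ (u≢v , uv≡c) = joinedG-across (u≢v ∘ sym) (trans (col-comm v u) uv≡c)
  ... | inj₂ (refl , nbr) with i≢j , ij≡c ← T-∧⁻ (not ⌊ i ≟ᶠ j ⌋) nbr =
    joinedG-within {u} {j} {i} {c} (T-∧⁺
      (fromWitnessFalse {a? = j ≟ᶠ i} (toWitnessFalse i≢j ∘ sym))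
      (fromWitness {a? = innerCol u j i ≟ᶠ c} (trans (innerCol-comm u (toWitnessFalse i≢j ∘ sym)) (toWitness ij≡c))))

  Valid : Set
  Valid = T (validInner k n col f)

  valid⇒inA : Valid → ∀ u {i j} → i <ᶠ j → T (inA Ĝ u (f u i j))
  valid⇒inA valid u {i} {j} i<j =
    subst (λ b → T (if b then inA Ĝ u (f u i j) else (f u i j ==ᶜ zero))) (⌊⌋-yes (i <ᶠ? j) i<j) cell
    where
    cellOk : Fin n → Fin n → Bool
    cellOk i j = if ⌊ i <ᶠ? j ⌋ then inA Ĝ u (f u i j) else (f u i j ==ᶜ zero)
    row : T (all (λ i → all (cellOk i) (allFin n)) (allFin n))
    row = All.lookup (all⁺ _ _ valid) (∈-allFin u)
    cell : T (cellOk i j)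
    cell = All.lookup (all⁺ (cellOk i) _ (All.lookup (all⁺ _ _ row) (∈-allFin i))) (∈-allFin j)

  innerCol-valid : Valid → ∀ u {i j} → i ≢ j → T (inA Ĝ u (innerCol u i j))
  innerCol-valid valid u {i} {j} i≢j with <ᶠ-cmp i j
  ... | tri< i<j _ _ = subst (T ∘ inA Ĝ u) (sym (innerCol-< u i<j)) (valid⇒inA valid u i<j)
  ... | tri≈ _ i≡j _ = contradiction i≡j i≢j
  ... | tri> _ _ j<i = subst (T ∘ inA Ĝ u) (sym (innerCol-> u j<i)) (valid⇒inA valid u j<i)

  innerNbr⇒inA : Valid → ∀ {u i c j} → T (innerNbr u i c j) → T (inA Ĝ u c)
  innerNbr⇒inA valid {u} {i} {c} {j} nbr with i≢j , col≡c ← T-∧⁻ (not ⌊ i ≟ᶠ j ⌋) nbr =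
    subst (T ∘ inA Ĝ u) (toWitness col≡c) (innerCol-valid valid u (toWitnessFalse i≢j))

  innerDeg-absent : Valid → ∀ u i {c} → ¬ T (inA Ĝ u c) → innerDeg u i c ≡ 0
  innerDeg-absent valid u i {c} c∉A = trans (sum-cong-≗ no-neighbour) (sum-replicate-zero n)
    where
    no-neighbour : ∀ j → ⟦ innerNbr u i c j ⟧ ≡ 0
    no-neighbour j with innerNbr u i c j in nbr
    ... | false = refl
    ... | true = contradiction (innerNbr⇒inA valid {j = j} (subst T (sym nbr) _)) c∉A

  inA-G⇒Ĝ : Valid → ∀ {u i c} → T (inA G (u , i) c) → T (inA Ĝ u c)
  inA-G⇒Ĝ valid {u} {i} {c} e
    with (v , j) , _ , e′ ← find (any⁻ (λ w → not (CG.eq? G w (u , i)) ∧ (CG.col G (u , i) w ==ᶜ c)) (CG.verts G) e)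
    = edge⇒inA v j (T-∧⁻ (not (CG.eq? G (v , j) (u , i))) e′)
    where
    edge⇒inA : ∀ v j → T (not (CG.eq? G (v , j) (u , i))) × T (CG.col G (u , i) (v , j) ==ᶜ c) → T (inA Ĝ u c)
    edge⇒inA v j (ne , ce) with u ≟ᶠ v
    ... | yes refl = subst (T ∘ inA Ĝ u) (toWitness ce) (innerCol-valid valid u (λ i≡j → G-≢ ne refl (sym i≡j)))
    ... | no u≢v = inAĜ-intro (u≢v ∘ sym) (toWitness ce)

  fullG⇒fullĜ : Valid → ∀ {u i c} → T (full G (u , i) c) → T (inA Ĝ u c) → T (fullĜ u)
  fullG⇒fullĜ valid {u} {i} {c} fullG c∈A = all-intro (inA Ĝ u) (allFin 3) colour
    where
    colour : ∀ c′ → T (inA Ĝ u c′)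
    colour c′ with T-∨⁻ (c′ ==ᶜ c) (All.lookup (all⁺ (λ c″ → (c″ ==ᶜ c) ∨ inA G (u , i) c″) (allFin 3) fullG) (∈-allFin c′))
    ... | inj₁ c′≡c = subst (T ∘ inA Ĝ u) (sym (toWitness c′≡c)) c∈A
    ... | inj₂ c′∈AG = inA-G⇒Ĝ valid c′∈AG

  -- A dominator of (v , j) in another class transfers to Ĝ; one in the same class needs the
  -- class itself to be dominated in Ĝ, unless it is one of the exceptional vertices E.
  lift-domination : (E : Fin k × Fin n → Set) (Tl : List (Fin k)) (S : List (Fin k × Fin n)) (c : Colour) →
    All (λ x → proj₁ x ∈ Tl × (T (sdom Ĝ Tl c (proj₁ x)) ⊎ E x)) S →
    ∀ v j → T (sdom G S c (v , j)) → T (sdom Ĝ Tl c v) ⊎ ∃[ i ] (E (v , i) × T (innerNbr v i c j))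
  lift-domination E Tl S c covered v j dom
    with (u , i) , x∈S , e ← find (any⁻ _ S dom)
    with u∈Tl , class ← All.lookup covered x∈S
    with joinedG e
  ... | inj₁ (u≢v , uv≡c) = inj₁ (dominatedĜ u∈Tl u≢v uv≡c)
  ... | inj₂ (refl , nbr) with class
  ...   | inj₁ u-dom = inj₁ u-dom
  ...   | inj₂ exc = inj₂ (i , exc , nbr)

  sumOver-vertices : (h : Fin k × Fin n → ℕ) → sumOver h (CG.verts G) ≡ ∑[ v < k ] ∑[ j < n ] h (v , j)
  sumOver-vertices h = begin
    sumOver h (CG.verts G)                                ≡⟨ sumOver-concatMap h _ (allFin k) ⟩
    sumOver (λ v → sumOver h (row v)) (allFin k)          ≡⟨ sumOver-tabulate (λ v → sumOver h (row v)) id ⟩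
    ∑[ v < k ] sumOver h (row v)                          ≡⟨ sum-cong-≗ (λ v → trans (sumOver-map h (v ,_) (allFin n))
                                                                                       (sumOver-tabulate (λ j → h (v , j)) id)) ⟩
    ∑[ v < k ] ∑[ j < n ] h (v , j)                       ∎
    where
    open ≡-Reasoning
    row : Fin k → List (Fin k × Fin n)
    row v = map (v ,_) (allFin n)

  domCount-blowup : (S : List (Fin k × Fin n)) (Tl : List (Fin k)) (c : Colour) (u : Fin k) (e : Fin n → Bool) →
    (∀ v j → T (sdom G S c (v , j)) → T (sdom Ĝ Tl c v) ⊎ (v ≡ u × T (e j))) →
    domCount G S c ≤ n * domCount Ĝ Tl c + ∑[ j < n ] ⟦ e j ⟧
  domCount-blowup S Tl c u e covered = begin
    domCount G S c                                ≡⟨ trans (countB≡sumOver _ (CG.verts G)) (sumOver-vertices _) ⟩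
    ∑[ v < k ] ∑[ j < n ] ⟦ sdom G S c (v , j) ⟧ ≤⟨ ∑-mono-≤ (λ v → ∑-mono-≤ (λ j → pointwise v j)) ⟩
    ∑[ v < k ] ∑[ j < n ] (d v + δ v * ε j)      ≡⟨ sum-cong-≗ (λ v → trans (∑-distrib-+ (λ _ → d v) (λ j → δ v * ε j))
                                                       (cong₂ _+_ (∑-const n (d v)) (sym (*-distribˡ-sum (δ v) ε)))) ⟩
    ∑[ v < k ] (n * d v + δ v * ∑[ j < n ] ε j)  ≡⟨ trans (∑-distrib-+ (λ v → n * d v) (λ v → δ v * ∑[ j < n ] ε j))
                                                       (cong₂ _+_ (sym (*-distribˡ-sum n d)) (∑-indicator u (λ _ → ∑[ j < n ] ε j))) ⟩
    n * ∑[ v < k ] d v + ∑[ j < n ] ε j          ≡⟨ cong (λ x → n * x + ∑[ j < n ] ε j)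
                                                       (sym (trans (countB≡sumOver (sdom Ĝ Tl c) (allFin k)) (sumOver-tabulate d id))) ⟩
    n * domCount Ĝ Tl c + ∑[ j < n ] ε j         ∎
    where
    open ≤-Reasoning
    d : Fin k → ℕ
    d v = ⟦ sdom Ĝ Tl c v ⟧
    δ : Fin k → ℕ
    δ v = ⟦ ⌊ v ≟ᶠ u ⌋ ⟧
    ε : Fin n → ℕ
    ε j = ⟦ e j ⟧
    pointwise : ∀ v j → ⟦ sdom G S c (v , j) ⟧ ≤ d v + δ v * ε j
    pointwise v j = subst (λ x → _ ≤ d v + x) (⟦∧⟧ ⌊ v ≟ᶠ u ⌋ (e j))
      (⟦⟧-≤-+ _ _ _ λ dom → map₂ (λ { (refl , ej) → T-∧⁺ (fromWitness refl) ej }) (covered v j dom))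

  colouredG : Colour → CG.V G → CG.V G → Set
  colouredG c a b = T (CG.col G a b ==ᶜ c)

  goodSet-cases : ∀ {c x y z} → T (goodSet G c x y z) →
    colouredG c x y × colouredG c x z ⊎ colouredG c x y × colouredG c y z ⊎ colouredG c x z × colouredG c y z ⊎
    colouredG c x y × T (full G z c) ⊎ colouredG c x z × T (full G y c) ⊎ colouredG c y z × T (full G x c)
  goodSet-cases {c} {x} {y} {z} =
    good-shape (CG.col G x y ==ᶜ c) (CG.col G x z ==ᶜ c) (CG.col G y z ==ᶜ c) (full G x c) (full G y c) (full G z c)

  LowInnerDegrees : ℕ → ℕ → Set
  LowInnerDegrees p q = ∀ w i c → T (fullĜ w) → 3 * q * innerDeg w i c ≤ (q + 3 * p) * n

  -- Three distinct vertices of Ĝ whose c-domination, blown up by n, accounts for that of S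
  -- up to an excess of at most (1/3 + p/q) n vertices.
  record Shadow (p q : ℕ) (S : List (Fin k × Fin n)) (c : Colour) : Set where
    field
      t₁ t₂ t₃ : Fin k
      t₁≢t₂ : t₁ ≢ t₂
      t₁≢t₃ : t₁ ≢ t₃
      t₂≢t₃ : t₂ ≢ t₃
      excess : ℕ
      excess-small : 3 * q * excess ≤ (q + 3 * p) * n
      domCount-≤ : domCount G S c ≤ n * domCount Ĝ (t₁ ∷ t₂ ∷ t₃ ∷ []) c + excess

  module _ {p q : ℕ} {S : List (Fin k × Fin n)} {c : Colour} (t₁ t₂ t₃ : Fin k)
           (t₁≢t₂ : t₁ ≢ t₂) (t₁≢t₃ : t₁ ≢ t₃) (t₂≢t₃ : t₂ ≢ t₃) where

    private
      Tl : List (Fin k)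
      Tl = t₁ ∷ t₂ ∷ t₃ ∷ []

    shadow-covered : All (λ x → proj₁ x ∈ Tl × T (sdom Ĝ Tl c (proj₁ x))) S → Shadow p q S c
    shadow-covered covered = record
      { t₁ = t₁ ; t₂ = t₂ ; t₃ = t₃ ; t₁≢t₂ = t₁≢t₂ ; t₁≢t₃ = t₁≢t₃ ; t₂≢t₃ = t₂≢t₃
      ; excess = 0 ; excess-small = subst (_≤ (q + 3 * p) * n) (sym (*-zeroʳ (3 * q))) z≤n
      ; domCount-≤ = subst (λ e → domCount G S c ≤ n * domCount Ĝ Tl c + e) (sum-replicate-zero n)
          (domCount-blowup S Tl c t₁ (λ _ → false) λ v j dom →
            map₂ (λ { (_ , () , _) }) (lift-domination (λ _ → ⊥) Tl S c (All.map (λ (u∈ , d) → u∈ , inj₁ d) covered) v j dom))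
      }

    shadow-exceptional : Valid → LowInnerDegrees p q → ∀ u i → T (full G (u , i) c) →
      All (λ x → proj₁ x ∈ Tl × (T (sdom Ĝ Tl c (proj₁ x)) ⊎ x ≡ (u , i))) S → Shadow p q S c
    shadow-exceptional valid sparse u i fullG covered = record
      { t₁ = t₁ ; t₂ = t₂ ; t₃ = t₃ ; t₁≢t₂ = t₁≢t₂ ; t₁≢t₃ = t₁≢t₃ ; t₂≢t₃ = t₂≢t₃
      ; excess = innerDeg u i c ; excess-small = excess-small
      ; domCount-≤ = domCount-blowup S Tl c u (innerNbr u i c) λ v j dom →
          map₂ (λ { (_ , refl , nbr) → refl , nbr }) (lift-domination (_≡ (u , i)) Tl S c covered v j dom)
      }
      where
      excess-small : 3 * q * innerDeg u i c ≤ (q + 3 * p) * n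
      excess-small with T? (inA Ĝ u c)
      ... | yes c∈A = sparse u i c (fullG⇒fullĜ valid fullG c∈A)
      ... | no c∉A = subst (_≤ (q + 3 * p) * n) (sym (trans (cong (3 * q *_) (innerDeg-absent valid u i c∉A)) (*-zeroʳ (3 * q)))) z≤n

  module _ {p q : ℕ} (k≥3 : 3 ≤ k) (col-comm : ∀ u v → col u v ≡ col v u) (valid : Valid) (sparse : LowInnerDegrees p q) where

    CommonColour : Colour → Fin k × Fin n → Fin k × Fin n → Fin k × Fin n → Set
    CommonColour c x y z = T (joined G c x z) ⊎ T (joined G c y z) ⊎ T (full G z c)

    edge-ends-dominated : ∀ {c u₁ u₂} t → u₁ ≢ u₂ → col u₁ u₂ ≡ c →
      T (sdom Ĝ (u₁ ∷ u₂ ∷ t ∷ []) c u₁) × T (sdom Ĝ (u₁ ∷ u₂ ∷ t ∷ []) c u₂)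
    edge-ends-dominated {u₁ = u₁} {u₂} t u₁≢u₂ e =
      dominatedĜ {Tl = u₁ ∷ u₂ ∷ t ∷ []} ∈₂ (u₁≢u₂ ∘ sym) (trans (col-comm u₂ u₁) e) ,
      dominatedĜ {Tl = u₁ ∷ u₂ ∷ t ∷ []} ∈₁ u₁≢u₂ e

    shadow-across : ∀ {c u₁ i₁ u₂ i₂ u₃ i₃} → u₁ ≢ u₂ → col u₁ u₂ ≡ c →
      CommonColour c (u₁ , i₁) (u₂ , i₂) (u₃ , i₃) → Shadow p q ((u₁ , i₁) ∷ (u₂ , i₂) ∷ (u₃ , i₃) ∷ []) c
    shadow-across {c} {u₁} {i₁} {u₂} {i₂} {u₃} {i₃} u₁≢u₂ e₁₂ cond with u₃ ≟ᶠ u₁ | u₃ ≟ᶠ u₂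
    ... | yes refl | _ =
      let t , t≢u₁ , t≢u₂ = third k≥3 u₁ u₂ ; dom₁ , dom₂ = edge-ends-dominated t u₁≢u₂ e₁₂ in
      shadow-covered u₁ u₂ t u₁≢u₂ (t≢u₁ ∘ sym) (t≢u₂ ∘ sym) ((∈₁ , dom₁) ∷ (∈₂ , dom₂) ∷ (∈₁ , dom₁) ∷ [])
    ... | no _ | yes refl =
      let t , t≢u₁ , t≢u₂ = third k≥3 u₁ u₂ ; dom₁ , dom₂ = edge-ends-dominated t u₁≢u₂ e₁₂ in
      shadow-covered u₁ u₂ t u₁≢u₂ (t≢u₁ ∘ sym) (t≢u₂ ∘ sym) ((∈₁ , dom₁) ∷ (∈₂ , dom₂) ∷ (∈₂ , dom₂) ∷ [])
    ... | no u₃≢u₁ | no u₃≢u₂ with cond | edge-ends-dominated u₃ u₁≢u₂ e₁₂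
    ...   | inj₁ j₁₃ | dom₁ , dom₂ = shadow-covered u₁ u₂ u₃ u₁≢u₂ (u₃≢u₁ ∘ sym) (u₃≢u₂ ∘ sym)
              ((∈₁ , dom₁) ∷ (∈₂ , dom₂) ∷ (∈₃ , dom₃) ∷ [])
      where
      dom₃ : T (sdom Ĝ (u₁ ∷ u₂ ∷ u₃ ∷ []) c u₃)
      dom₃ = dominatedĜ {Tl = u₁ ∷ u₂ ∷ u₃ ∷ []} ∈₁ (u₃≢u₁ ∘ sym) (joined-across j₁₃ (u₃≢u₁ ∘ sym))
    ...   | inj₂ (inj₁ j₂₃) | dom₁ , dom₂ = shadow-covered u₁ u₂ u₃ u₁≢u₂ (u₃≢u₁ ∘ sym) (u₃≢u₂ ∘ sym)
              ((∈₁ , dom₁) ∷ (∈₂ , dom₂) ∷ (∈₃ , dom₃) ∷ [])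
      where
      dom₃ : T (sdom Ĝ (u₁ ∷ u₂ ∷ u₃ ∷ []) c u₃)
      dom₃ = dominatedĜ {Tl = u₁ ∷ u₂ ∷ u₃ ∷ []} ∈₂ (u₃≢u₂ ∘ sym) (joined-across j₂₃ (u₃≢u₂ ∘ sym))
    ...   | inj₂ (inj₂ fullG) | dom₁ , dom₂ = shadow-exceptional u₁ u₂ u₃ u₁≢u₂ (u₃≢u₁ ∘ sym) (u₃≢u₂ ∘ sym) valid sparse u₃ i₃ fullG
              ((∈₁ , inj₁ dom₁) ∷ (∈₂ , inj₁ dom₂) ∷ (∈₃ , inj₂ refl) ∷ [])

    shadow-within : ∀ {c u i₁ i₂ u₃ i₃} → T (innerNbr u i₁ c i₂) →
      CommonColour c (u , i₁) (u , i₂) (u₃ , i₃) → Shadow p q ((u , i₁) ∷ (u , i₂) ∷ (u₃ , i₃) ∷ []) c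
    shadow-within {c} {u} {i₁} {i₂} {u₃} {i₃} nbr cond
      with t , t≢u , ut≡c ← inAĜ-elim (innerNbr⇒inA valid {u} {i₁} {c} {i₂} nbr) | u₃ ≟ᶠ u
    ... | yes refl =
      let t′ , t′≢u , t′≢t = third k≥3 u t
          dom = dominatedĜ {Tl = u ∷ t ∷ t′ ∷ []} ∈₂ t≢u (trans (col-comm t u) ut≡c) in
      shadow-covered u t t′ (t≢u ∘ sym) (t′≢u ∘ sym) (t′≢t ∘ sym) ((∈₁ , dom) ∷ (∈₁ , dom) ∷ (∈₁ , dom) ∷ [])
    ... | no u₃≢u with col u u₃ ≟ᶠ c
    ...   | yes uu₃≡c =
      let t′ , t′≢u , t′≢u₃ = third k≥3 u u₃ ; dom₁ , dom₃ = edge-ends-dominated t′ (u₃≢u ∘ sym) uu₃≡c in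
      shadow-covered u u₃ t′ (u₃≢u ∘ sym) (t′≢u ∘ sym) (t′≢u₃ ∘ sym) ((∈₁ , dom₁) ∷ (∈₁ , dom₁) ∷ (∈₂ , dom₃) ∷ [])
    ...   | no uu₃≢c =
      shadow-exceptional u u₃ t (u₃≢u ∘ sym) (t≢u ∘ sym) (λ u₃≡t → uu₃≢c (trans (cong (col u) u₃≡t) ut≡c))
        valid sparse u₃ i₃ (fullG cond) ((∈₁ , inj₁ dom) ∷ (∈₁ , inj₁ dom) ∷ (∈₂ , inj₂ refl) ∷ [])
      where
      dom : T (sdom Ĝ (u ∷ u₃ ∷ t ∷ []) c u)
      dom = dominatedĜ {Tl = u ∷ u₃ ∷ t ∷ []} ∈₃ t≢u (trans (col-comm t u) ut≡c)
      fullG : CommonColour c (u , i₁) (u , i₂) (u₃ , i₃) → T (full G (u₃ , i₃) c)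
      fullG (inj₁ j₁₃) = contradiction (joined-across j₁₃ (u₃≢u ∘ sym)) uu₃≢c
      fullG (inj₂ (inj₁ j₂₃)) = contradiction (joined-across j₂₃ (u₃≢u ∘ sym)) uu₃≢c
      fullG (inj₂ (inj₂ full₃)) = full₃

    shadow : ∀ {c} x y z → T (joined G c x y) → CommonColour c x y z → Shadow p q (x ∷ y ∷ z ∷ []) c
    shadow (u₁ , i₁) (u₂ , i₂) z xy cond with u₁ ≟ᶠ u₂
    ... | yes refl = shadow-within xy cond
    ... | no u₁≢u₂ = shadow-across u₁≢u₂ (toWitness xy) cond

    shadow-cong : ∀ {S S′ c} → (∀ v → sdom G S c v ≡ sdom G S′ c v) → Shadow p q S c → Shadow p q S′ c
    shadow-cong {S} {S′} {c} same sh = record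
      { t₁ = t₁ ; t₂ = t₂ ; t₃ = t₃ ; t₁≢t₂ = t₁≢t₂ ; t₁≢t₃ = t₁≢t₃ ; t₂≢t₃ = t₂≢t₃
      ; excess = excess ; excess-small = excess-small
      ; domCount-≤ = subst (_≤ _) (countB-cong (CG.verts G) same) domCount-≤
      }
      where open Shadow sh

    shadow-swap₁₂ : ∀ {x y z c} → Shadow p q (y ∷ x ∷ z ∷ []) c → Shadow p q (x ∷ y ∷ z ∷ []) c
    shadow-swap₁₂ {x} {y} {z} {c} = shadow-cong λ v → ∨-swap (joined G c y v) (joined G c x v) _

    shadow-swap₂₃ : ∀ {x y z c} → Shadow p q (x ∷ z ∷ y ∷ []) c → Shadow p q (x ∷ y ∷ z ∷ []) c
    shadow-swap₂₃ {x} {y} {z} {c} = shadow-cong λ v → cong (joined G c x v ∨_) (∨-swap (joined G c z v) (joined G c y v) false)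

    good⇒shadow : ∀ {c x y z} → T (distinct3 G x y z) → T (goodSet G c x y z) → Shadow p q (x ∷ y ∷ z ∷ []) c
    good⇒shadow {c} {x} {y} {z} distinct good
      with x≢y , x≢z,y≢z ← T-∧⁻ (not (CG.eq? G x y)) distinct
      with x≢z , y≢z ← T-∧⁻ (not (CG.eq? G x z)) x≢z,y≢z
      with goodSet-cases good
    ... | inj₁ (xy , xz) = shadow x y z (T-∧⁺ x≢y xy) (inj₁ (T-∧⁺ x≢z xz))
    ... | inj₂ (inj₁ (xy , yz)) = shadow x y z (T-∧⁺ x≢y xy) (inj₂ (inj₁ (T-∧⁺ y≢z yz)))
    ... | inj₂ (inj₂ (inj₁ (xz , yz))) =
      shadow-swap₂₃ (shadow x z y (T-∧⁺ x≢z xz) (inj₂ (inj₁ (joined-comm col-comm {y} {z} {c} (T-∧⁺ y≢z yz)))))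
    ... | inj₂ (inj₂ (inj₂ (inj₁ (xy , fz)))) = shadow x y z (T-∧⁺ x≢y xy) (inj₂ (inj₂ fz))
    ... | inj₂ (inj₂ (inj₂ (inj₂ (inj₁ (xz , fy))))) = shadow-swap₂₃ (shadow x z y (T-∧⁺ x≢z xz) (inj₂ (inj₂ fy)))
    ... | inj₂ (inj₂ (inj₂ (inj₂ (inj₂ (yz , fx))))) =
      shadow-swap₁₂ (shadow-swap₂₃ (shadow y z x (T-∧⁺ y≢z yz) (inj₂ (inj₂ fx))))

    module _ (few : TriplesDominateFew) where

      shadow⇒bounded : ∀ {S c} → Shadow p q S c → 3 * q * domCount G S c ≤ (2 * q + 3 * p) * (n * k)
      shadow⇒bounded {S} {c} sh = blowup-arithmetic p q n k domCount-≤ (few c t₁ t₂ t₃ t₁≢t₂ t₁≢t₃ t₂≢t₃) excess-small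
        where open Shadow sh

      allGoodBounded-holds : T (allGoodBounded G p q (n * k))
      allGoodBounded-holds =
        all-intro _ (allFin 3) λ c → all-intro _ (CG.verts G) λ x → all-intro _ (CG.verts G) λ y → all-intro _ (CG.verts G) λ z →
          T-⇒ (distinct3 G x y z ∧ goodSet G c x y z) _ λ dg →
            let distinct , good = T-∧⁻ (distinct3 G x y z) dg in ≤⇒≤ᵇ (shadow⇒bounded (good⇒shadow {c} {x} {y} {z} distinct good))

-- Exponential moments of inner colour counts

module Moments (k n : ℕ) (col : Fin k → Fin k → Colour) where

  open BaseGraph k col using (Ĝ; fullĜ)

  ∑³ : (Fin k → Fin n → Fin n → ℕ) → ℕ
  ∑³ g = ∑[ u < k ] ∑[ i < n ] ∑[ j < n ] g u i j

  ∏³ : (Fin k → Fin n → Fin n → ℕ) → ℕ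
  ∏³ g = ∏ (λ u → ∏ (λ i → ∏ (λ j → g u i j)))

  ∏³-cong : {g h : Fin k → Fin n → Fin n → ℕ} → (∀ u i j → g u i j ≡ h u i j) → ∏³ g ≡ ∏³ h
  ∏³-cong e = ∏-cong (λ u → ∏-cong (λ i → ∏-cong (λ j → e u i j)))

  ∏³-distrib-* : (g h : Fin k → Fin n → Fin n → ℕ) → ∏³ (λ u i j → g u i j * h u i j) ≡ ∏³ g * ∏³ h
  ∏³-distrib-* g h =
    trans (∏-cong (λ u → trans (∏-cong (λ i → ∏-distrib-* (g u i) (h u i)))
                                (∏-distrib-* (λ i → ∏ (g u i)) (λ i → ∏ (h u i)))))
          (∏-distrib-* (λ u → ∏ (λ i → ∏ (g u i))) (λ u → ∏ (λ i → ∏ (h u i))))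

  ∏³-pow : (X : ℕ) (e : Fin k → Fin n → Fin n → ℕ) → ∏³ (λ u i j → X ^ e u i j) ≡ X ^ ∑³ e
  ∏³-pow X e = trans (∏-cong (λ u → trans (∏-cong (λ i → ∏-pow X (e u i))) (∏-pow X (λ i → ∑[ j < n ] e u i j))))
                     (∏-pow X (λ u → ∑[ i < n ] ∑[ j < n ] e u i j))

  cellwise : (Fin k → Fin n → Fin n → Colour → ℕ) → Inner k n → ℕ
  cellwise φ f = ∏³ (λ u i j → φ u i j (f u i j))

  sumOver-allInner : (φ : Fin k → Fin n → Fin n → Colour → ℕ) →
                     sumOver (cellwise φ) (allInner k n) ≡ ∏³ (λ u i j → sumOver (φ u i j) (allFin 3))
  sumOver-allInner φ =
    trans (sumOver-allFuns k _ (λ u g → ∏ (λ i → ∏ (λ j → φ u i j (g i j)))))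
      (∏-cong (λ u → trans (sumOver-allFuns n _ (λ i r → ∏ (λ j → φ u i j (r j))))
        (∏-cong (λ i → sumOver-allFuns n (allFin 3) (φ u i)))))

  ∑³-cong : {g h : Fin k → Fin n → Fin n → ℕ} → (∀ u i j → g u i j ≡ h u i j) → ∑³ g ≡ ∑³ h
  ∑³-cong e = sum-cong-≗ (λ u → sum-cong-≗ (λ i → sum-cong-≗ (λ j → e u i j)))

  ∑³-+ : (g h : Fin k → Fin n → Fin n → ℕ) → ∑³ (λ u i j → g u i j + h u i j) ≡ ∑³ g + ∑³ h
  ∑³-+ g h = trans (sum-cong-≗ (λ u → trans (sum-cong-≗ (λ i → ∑-distrib-+ (g u i) (h u i)))
                                          (∑-distrib-+ (λ i → ∑[ j < n ] g u i j) (λ i → ∑[ j < n ] h u i j))))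
                   (∑-distrib-+ (λ u → ∑[ i < n ] ∑[ j < n ] g u i j) (λ u → ∑[ i < n ] ∑[ j < n ] h u i j))

  allowed : Fin k → Fin n → Fin n → Colour → Bool
  allowed u i j x = if ⌊ i <ᶠ? j ⌋ then inA Ĝ u x else (x ==ᶜ zero)

  ⟦validInner⟧ : (f : Inner k n) → ⟦ validInner k n col f ⟧ ≡ cellwise (λ u i j x → ⟦ allowed u i j x ⟧) f
  ⟦validInner⟧ f =
    trans (⟦all⟧ (λ u → all (λ i → all (λ j → allowed u i j (f u i j)) (allFin n)) (allFin n)) id)
      (∏-cong (λ u → trans (⟦all⟧ (λ i → all (λ j → allowed u i j (f u i j)) (allFin n)) id)
        (∏-cong (λ i → ⟦all⟧ (λ j → allowed u i j (f u i j)) id))))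

  numAllowed : Fin k → Fin n → Fin n → ℕ
  numAllowed u i j = sumOver (⟦_⟧ ∘ allowed u i j) (allFin 3)

  numOutcomes≡∏ : numOutcomes k n col ≡ ∏³ numAllowed
  numOutcomes≡∏ = trans (countB≡sumOver (validInner k n col) (allInner k n))
    (trans (sumOver-cong (allInner k n) ⟦validInner⟧) (sumOver-allInner (λ u i j x → ⟦ allowed u i j x ⟧)))

  -- Among cells F on which every colour is allowed, weight each c-coloured cell by α and every
  -- other one by β; each cell of F then independently contributes a factor (α + 2β)/3.
  module ExponentialMoment (c : Colour) (α β : ℕ) (F : Fin k → Fin n → Fin n → Bool)
    (F-free : ∀ {u i j} → T (F u i j) → ∀ x → T (allowed u i j x)) where

    hits : Inner k n → ℕ
    hits f = ∑³ (λ u i j → ⟦ F u i j ∧ (f u i j ==ᶜ c) ⟧)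

    misses : Inner k n → ℕ
    misses f = ∑³ (λ u i j → ⟦ F u i j ∧ not (f u i j ==ᶜ c) ⟧)

    size : ℕ
    size = ∑³ (λ u i j → ⟦ F u i j ⟧)

    hits+misses : ∀ f → hits f + misses f ≡ size
    hits+misses f = trans (sym (∑³-+ _ _)) (∑³-cong (λ u i j → split (F u i j) (f u i j ==ᶜ c)))
      where
      split : ∀ a b → ⟦ a ∧ b ⟧ + ⟦ a ∧ not b ⟧ ≡ ⟦ a ⟧
      split true true = refl
      split true false = refl
      split false b = refl

    private
      ψ : Fin k → Fin n → Fin n → Colour → ℕ
      ψ u i j x = ⟦ allowed u i j x ⟧ * (α ^ ⟦ F u i j ∧ (x ==ᶜ c) ⟧ * β ^ ⟦ F u i j ∧ not (x ==ᶜ c) ⟧)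

      weight≡cellwise : ∀ f → ⟦ validInner k n col f ⟧ * (α ^ hits f * β ^ misses f) ≡ cellwise ψ f
      weight≡cellwise f = sym (begin
        cellwise ψ f
          ≡⟨ ∏³-distrib-* (λ u i j → ⟦ allowed u i j (f u i j) ⟧) (λ u i j → α ^ h u i j * β ^ m u i j) ⟩
        cellwise (λ u i j x → ⟦ allowed u i j x ⟧) f * ∏³ (λ u i j → α ^ h u i j * β ^ m u i j)
          ≡⟨ cong₂ _*_ (sym (⟦validInner⟧ f)) (∏³-distrib-* (λ u i j → α ^ h u i j) (λ u i j → β ^ m u i j)) ⟩
        ⟦ validInner k n col f ⟧ * (∏³ (λ u i j → α ^ h u i j) * ∏³ (λ u i j → β ^ m u i j))
          ≡⟨ cong (⟦ validInner k n col f ⟧ *_) (cong₂ _*_ (∏³-pow α h) (∏³-pow β m)) ⟩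
        ⟦ validInner k n col f ⟧ * (α ^ hits f * β ^ misses f) ∎)
        where
        open ≡-Reasoning
        h m : Fin k → Fin n → Fin n → ℕ
        h u i j = ⟦ F u i j ∧ (f u i j ==ᶜ c) ⟧
        m u i j = ⟦ F u i j ∧ not (f u i j ==ᶜ c) ⟧

      colour-sum : ∀ c → sumOver (λ x → α ^ ⟦ x ==ᶜ c ⟧ * β ^ ⟦ not (x ==ᶜ c) ⟧) (allFin 3) ≡ α + 2 * β
      colour-sum zero = expand α β
        where
        expand : ∀ α β → α * 1 * 1 + (1 * (β * 1) + (1 * (β * 1) + 0)) ≡ α + 2 * β
        expand = solve-∀
      colour-sum (suc zero) = expand α β
        where
        expand : ∀ α β → 1 * (β * 1) + (α * 1 * 1 + (1 * (β * 1) + 0)) ≡ α + 2 * β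
        expand = solve-∀
      colour-sum (suc (suc zero)) = expand α β
        where
        expand : ∀ α β → 1 * (β * 1) + (1 * (β * 1) + (α * 1 * 1 + 0)) ≡ α + 2 * β
        expand = solve-∀

      cell : ∀ u i j → sumOver (ψ u i j) (allFin 3) * 3 ^ ⟦ F u i j ⟧ ≡ numAllowed u i j * (α + 2 * β) ^ ⟦ F u i j ⟧
      cell u i j = cell-with (F u i j) F-free
        where
        cell-with : ∀ b → (T b → ∀ x → T (allowed u i j x)) →
          sumOver (λ x → ⟦ allowed u i j x ⟧ * (α ^ ⟦ b ∧ (x ==ᶜ c) ⟧ * β ^ ⟦ b ∧ not (x ==ᶜ c) ⟧)) (allFin 3) * 3 ^ ⟦ b ⟧
          ≡ numAllowed u i j * (α + 2 * β) ^ ⟦ b ⟧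
        cell-with false _ = cong (_* 1) (sumOver-cong (allFin 3) λ x → *-identityʳ ⟦ allowed u i j x ⟧)
        cell-with true free = begin
          sumOver (λ x → ⟦ allowed u i j x ⟧ * (α ^ ⟦ x ==ᶜ c ⟧ * β ^ ⟦ not (x ==ᶜ c) ⟧)) (allFin 3) * 3
            ≡⟨ cong (_* 3) (sumOver-cong (allFin 3) λ x → trans (cong (_* weight x) (⟦allowed⟧≡1 x)) (*-identityˡ (weight x))) ⟩
          sumOver (λ x → α ^ ⟦ x ==ᶜ c ⟧ * β ^ ⟦ not (x ==ᶜ c) ⟧) (allFin 3) * 3
            ≡⟨ cong (_* 3) (colour-sum c) ⟩
          (α + 2 * β) * 3                          ≡⟨ *-comm (α + 2 * β) 3 ⟩
          3 * (α + 2 * β)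
            ≡⟨ cong₂ _*_ (sym (sumOver-cong {h = λ _ → 1} (allFin 3) ⟦allowed⟧≡1)) (sym (*-identityʳ (α + 2 * β))) ⟩
          numAllowed u i j * (α + 2 * β) ^ 1       ∎
          where
          open ≡-Reasoning
          weight : Colour → ℕ
          weight x = α ^ ⟦ x ==ᶜ c ⟧ * β ^ ⟦ not (x ==ᶜ c) ⟧
          ⟦allowed⟧≡1 : ∀ x → ⟦ allowed u i j x ⟧ ≡ 1
          ⟦allowed⟧≡1 x with allowed u i j x | free _ x
          ... | true | _ = refl

    exponential-moment : sumOver (λ f → ⟦ validInner k n col f ⟧ * (α ^ hits f * β ^ misses f)) (allInner k n) * 3 ^ size
                         ≡ numOutcomes k n col * (α + 2 * β) ^ size
    exponential-moment = begin
      sumOver (λ f → ⟦ validInner k n col f ⟧ * (α ^ hits f * β ^ misses f)) (allInner k n) * 3 ^ size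
        ≡⟨ cong (_* 3 ^ size) (trans (sumOver-cong (allInner k n) weight≡cellwise) (sumOver-allInner ψ)) ⟩
      ∏³ (λ u i j → sumOver (ψ u i j) (allFin 3)) * 3 ^ size
        ≡⟨ trans (cong (∏³ Σψ *_) (sym (∏³-pow 3 F′))) (sym (∏³-distrib-* Σψ (λ u i j → 3 ^ F′ u i j))) ⟩
      ∏³ (λ u i j → sumOver (ψ u i j) (allFin 3) * 3 ^ ⟦ F u i j ⟧)
        ≡⟨ ∏³-cong cell ⟩
      ∏³ (λ u i j → numAllowed u i j * (α + 2 * β) ^ ⟦ F u i j ⟧)
        ≡⟨ trans (∏³-distrib-* numAllowed (λ u i j → (α + 2 * β) ^ F′ u i j))
                 (cong₂ _*_ (sym numOutcomes≡∏) (∏³-pow (α + 2 * β) F′)) ⟩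
      numOutcomes k n col * (α + 2 * β) ^ size ∎
      where
      open ≡-Reasoning
      F′ Σψ : Fin k → Fin n → Fin n → ℕ
      F′ u i j = ⟦ F u i j ⟧
      Σψ u i j = sumOver (ψ u i j) (allFin 3)

  -- The cells carrying the edges from (w , i₀) to the other vertices of its class.
  module Star (w : Fin k) (i₀ : Fin n) where

    star : Fin k → Fin n → Fin n → Bool
    star u i j = ⌊ u ≟ᶠ w ⌋ ∧ ((⌊ i ≟ᶠ i₀ ⌋ ∧ ⌊ i₀ <ᶠ? j ⌋) ∨ (⌊ j ≟ᶠ i₀ ⌋ ∧ ⌊ i <ᶠ? i₀ ⌋))

    star-cell : ∀ {u i j} → T (star u i j) → u ≡ w × i <ᶠ j
    star-cell {u} {i} {j} s with u≡w , on ← T-∧⁻ ⌊ u ≟ᶠ w ⌋ s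
      with T-∨⁻ (⌊ i ≟ᶠ i₀ ⌋ ∧ ⌊ i₀ <ᶠ? j ⌋) on
    ... | inj₁ from = let i≡i₀ , i₀<j = T-∧⁻ ⌊ i ≟ᶠ i₀ ⌋ from in
      toWitness u≡w , subst (_<ᶠ j) (sym (toWitness i≡i₀)) (toWitness i₀<j)
    ... | inj₂ to = let j≡i₀ , i<i₀ = T-∧⁻ ⌊ j ≟ᶠ i₀ ⌋ to in
      toWitness u≡w , subst (i <ᶠ_) (sym (toWitness j≡i₀)) (toWitness i<i₀)

    star-free : T (fullĜ w) → ∀ {u i j} → T (star u i j) → ∀ x → T (allowed u i j x)
    star-free full {u} {i} {j} s x with refl , i<j ← star-cell {u} {i} {j} s =
      subst (λ b → T (if b then inA Ĝ w x else (x ==ᶜ zero))) (sym (⌊⌋-yes (i <ᶠ? j) i<j))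
        (All.lookup (all⁺ (inA Ĝ w) (allFin 3) full) (∈-allFin x))

    on-star : ∀ i j b → ⟦ ((⌊ i ≟ᶠ i₀ ⌋ ∧ ⌊ i₀ <ᶠ? j ⌋) ∨ (⌊ j ≟ᶠ i₀ ⌋ ∧ ⌊ i <ᶠ? i₀ ⌋)) ∧ b ⟧
                      ≡ ⟦ ⌊ i ≟ᶠ i₀ ⌋ ⟧ * ⟦ ⌊ i₀ <ᶠ? j ⌋ ∧ b ⟧ + ⟦ ⌊ j ≟ᶠ i₀ ⌋ ⟧ * ⟦ ⌊ i <ᶠ? i₀ ⌋ ∧ b ⟧
    on-star i j b with i ≟ᶠ i₀ | j ≟ᶠ i₀
    ... | yes refl | yes refl rewrite ⌊⌋-no (i <ᶠ? i) (<ᶠ-irrefl refl) = refl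
    ... | yes refl | no _ = ∨-false (⌊ i <ᶠ? j ⌋) b
      where
      ∨-false : ∀ x b → ⟦ (x ∨ false) ∧ b ⟧ ≡ ⟦ x ∧ b ⟧ + 0 + 0
      ∨-false true true = refl
      ∨-false true false = refl
      ∨-false false b = refl
    ... | no _ | yes refl = sym (+-identityʳ _)
    ... | no _ | no _ = refl

    star-sum : (e : Fin k → Fin n → Fin n → Bool) → ∑³ (λ u i j → ⟦ star u i j ∧ e u i j ⟧)
               ≡ ∑[ j < n ] ⟦ ⌊ i₀ <ᶠ? j ⌋ ∧ e w i₀ j ⟧ + ∑[ i < n ] ⟦ ⌊ i <ᶠ? i₀ ⌋ ∧ e w i i₀ ⟧
    star-sum e = begin
      ∑³ (λ u i j → ⟦ star u i j ∧ e u i j ⟧)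
        ≡⟨ sum-cong-≗ (λ u → trans (sum-cong-≗ λ i → trans (sum-cong-≗ λ j → class u i j)
                                                          (sym (*-distribˡ-sum (δ u) (λ j → ⟦ on u i j ⟧))))
                                   (sym (*-distribˡ-sum (δ u) (λ i → ∑[ j < n ] ⟦ on u i j ⟧)))) ⟩
      ∑[ u < k ] (δ u * ∑[ i < n ] ∑[ j < n ] ⟦ on u i j ⟧)
        ≡⟨ ∑-indicator w (λ u → ∑[ i < n ] ∑[ j < n ] ⟦ on u i j ⟧) ⟩
      ∑[ i < n ] ∑[ j < n ] ⟦ on w i j ⟧
        ≡⟨ sum-cong-≗ (λ i → trans (sum-cong-≗ λ j → on-star i j (e w i j)) (∑-distrib-+ (from i) (to i))) ⟩
      ∑[ i < n ] (∑[ j < n ] from i j + ∑[ j < n ] to i j)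
        ≡⟨ ∑-distrib-+ (λ i → ∑[ j < n ] from i j) (λ i → ∑[ j < n ] to i j) ⟩
      ∑[ i < n ] ∑[ j < n ] from i j + ∑[ i < n ] ∑[ j < n ] to i j
        ≡⟨ cong₂ _+_ (trans (sum-cong-≗ λ i → sym (*-distribˡ-sum ⟦ ⌊ i ≟ᶠ i₀ ⌋ ⟧ (λ j → ⟦ ⌊ i₀ <ᶠ? j ⌋ ∧ e w i j ⟧)))
                              (∑-indicator i₀ (λ i → ∑[ j < n ] ⟦ ⌊ i₀ <ᶠ? j ⌋ ∧ e w i j ⟧)))
                       (sum-cong-≗ λ i → ∑-indicator i₀ (λ j → ⟦ ⌊ i <ᶠ? i₀ ⌋ ∧ e w i j ⟧)) ⟩
      ∑[ j < n ] ⟦ ⌊ i₀ <ᶠ? j ⌋ ∧ e w i₀ j ⟧ + ∑[ i < n ] ⟦ ⌊ i <ᶠ? i₀ ⌋ ∧ e w i i₀ ⟧ ∎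
      where
      open ≡-Reasoning
      δ : Fin k → ℕ
      δ u = ⟦ ⌊ u ≟ᶠ w ⌋ ⟧
      on : Fin k → Fin n → Fin n → Bool
      on u i j = ((⌊ i ≟ᶠ i₀ ⌋ ∧ ⌊ i₀ <ᶠ? j ⌋) ∨ (⌊ j ≟ᶠ i₀ ⌋ ∧ ⌊ i <ᶠ? i₀ ⌋)) ∧ e u i j
      from to : Fin n → Fin n → ℕ
      from i j = ⟦ ⌊ i ≟ᶠ i₀ ⌋ ⟧ * ⟦ ⌊ i₀ <ᶠ? j ⌋ ∧ e w i j ⟧
      to i j = ⟦ ⌊ j ≟ᶠ i₀ ⌋ ⟧ * ⟦ ⌊ i <ᶠ? i₀ ⌋ ∧ e w i j ⟧
      class : ∀ u i j → ⟦ star u i j ∧ e u i j ⟧ ≡ δ u * ⟦ on u i j ⟧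
      class u i j = trans (cong ⟦_⟧ (∧-assoc ⌊ u ≟ᶠ w ⌋ _ _)) (⟦∧⟧ ⌊ u ≟ᶠ w ⌋ _)

    star-size : suc (∑³ (λ u i j → ⟦ star u i j ⟧)) ≡ n
    star-size = begin
      suc (∑³ (λ u i j → ⟦ star u i j ⟧))
        ≡⟨ cong suc (trans (∑³-cong λ u i j → cong ⟦_⟧ (sym (∧-identityʳ (star u i j)))) (star-sum λ _ _ _ → true)) ⟩
      suc (∑[ j < n ] lt j + ∑[ j < n ] gt j)
        ≡⟨ trans (+-comm 1 (∑[ j < n ] lt j + ∑[ j < n ] gt j)) (cong (∑[ j < n ] lt j + ∑[ j < n ] gt j +_) (sym (∑-indicator i₀ λ _ → 1))) ⟩
      ∑[ j < n ] lt j + ∑[ j < n ] gt j + ∑[ j < n ] (eq j * 1)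
        ≡⟨ sym (trans (∑-distrib-+ (λ j → lt j + gt j) (λ j → eq j * 1)) (cong (_+ ∑[ j < n ] (eq j * 1)) (∑-distrib-+ lt gt))) ⟩
      ∑[ j < n ] (lt j + gt j + eq j * 1)
        ≡⟨ sum-cong-≗ (λ j → trans (cong₂ (λ a b → ⟦ a ⟧ + ⟦ b ⟧ + eq j * 1) (∧-identityʳ ⌊ i₀ <ᶠ? j ⌋) (∧-identityʳ ⌊ j <ᶠ? i₀ ⌋))
                                   (trans (cong (⟦ ⌊ i₀ <ᶠ? j ⌋ ⟧ + ⟦ ⌊ j <ᶠ? i₀ ⌋ ⟧ +_) (*-identityʳ (eq j))) (⟦<⟧+⟦>⟧+⟦≡⟧ i₀ j))) ⟩
      ∑[ j < n ] 1
        ≡⟨ trans (∑-const n 1) (*-identityʳ n) ⟩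
      n ∎
      where
      open ≡-Reasoning
      lt gt eq : Fin n → ℕ
      lt j = ⟦ ⌊ i₀ <ᶠ? j ⌋ ∧ true ⟧
      gt j = ⟦ ⌊ j <ᶠ? i₀ ⌋ ∧ true ⟧
      eq j = ⟦ ⌊ j ≟ᶠ i₀ ⌋ ⟧

-- Counting outcomes

-- Colour c and the other colours on the star of a vertex are weighted by α and β; the star of
-- a vertex with too many inner c-neighbours has weight at least K^(n-1).
module ChernoffWeights (q′ : ℕ) where

  q : ℕ
  q = suc q′

  L α β K : ℕ
  L = chernoffBase q′
  α = suc L ^ (3 * q)
  β = L ^ (3 * q)
  K = suc L ^ suc q * L ^ (q + q′)

  α+2β≥1 : 1 ≤ α + 2 * β
  α+2β≥1 = ≤-trans (m^n>0 (suc L) (3 * q)) (m≤m+n α (2 * β))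

  3K≢0 : NonZero (3 * K)
  3K≢0 = >-nonZero (≤-trans (s≤s z≤n) (chernoff-weights q′))

module Counting (k : ℕ) (k≥3 : 3 ≤ k) (col : Fin k → Fin k → Colour) (col-comm : ∀ u v → col u v ≡ col v u)
                (few : BaseGraph.TriplesDominateFew k col) (p q′ : ℕ) (p>0 : 0 < p) (n : ℕ) where

  open ChernoffWeights q′

  open BaseGraph k col using (fullĜ)
  module B = Blowup k n col

  heavy : Inner k n → Fin k → Fin n → Colour → Bool
  heavy f w i c = fullĜ w ∧ not (3 * q * B.innerDeg f w i c ≤ᵇ (q + 3 * p) * n)

  numHeavy : Fin k → Fin n → Colour → ℕ
  numHeavy w i c = countB (λ f → validInner k n col f ∧ heavy f w i c) (allInner k n)

  module _ (w : Fin k) (i₀ : Fin n) (c : Colour) (full : T (fullĜ w)) where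
    open Moments k n col
    open Star w i₀
    open ExponentialMoment c α β star (star-free full)

    hits≡innerDeg : ∀ f → hits f ≡ B.innerDeg f w i₀ c
    hits≡innerDeg f = trans (star-sum λ u i j → f u i j ==ᶜ c) (sym (B.innerDeg-split f w i₀ c))

    heavy⇒K^size≤ : ∀ f → T (heavy f w i₀ c) → K ^ size ≤ α ^ hits f * β ^ misses f
    heavy⇒K^size≤ f h = begin
      K ^ size
        ≡⟨ trans (^-distribʳ-* (suc L ^ suc q) (L ^ (q + q′)) size)
                 (cong₂ _*_ (^-*-assoc (suc L) (suc q) size) (^-*-assoc L (q + q′) size)) ⟩
      suc L ^ (suc q * size) * L ^ ((q + q′) * size)
        ≤⟨ pow-shift (suc q * size) ((q + q′) * size) (3 * q * hits f) (3 * q * misses f) (n≤1+n L) frequent exponents ⟩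
      suc L ^ (3 * q * hits f) * L ^ (3 * q * misses f)
        ≡⟨ sym (cong₂ _*_ (^-*-assoc (suc L) (3 * q) (hits f)) (^-*-assoc L (3 * q) (misses f))) ⟩
      α ^ hits f * β ^ misses f ∎
      where
      open ≤-Reasoning
      dense : (q + 3 * p) * n < 3 * q * hits f
      dense = subst (λ h → (q + 3 * p) * n < 3 * q * h) (sym (hits≡innerDeg f))
                (≰⇒> λ le → T-not _ (proj₂ (T-∧⁻ (fullĜ w) h)) (≤⇒≤ᵇ le))
      frequent : suc q * size ≤ 3 * q * hits f
      frequent = begin
        suc q * size       ≤⟨ *-monoʳ-≤ (suc q) (subst (size ≤_) star-size (n≤1+n size)) ⟩
        suc q * n          ≤⟨ *-monoˡ-≤ n (subst (_≤ q + 3 * p) (+-comm q 1) (+-monoʳ-≤ q (≤-trans p>0 (m≤n*m p 3)))) ⟩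
        (q + 3 * p) * n    ≤⟨ <⇒≤ dense ⟩
        3 * q * hits f     ∎
      exponents : 3 * q * hits f + 3 * q * misses f ≡ suc q * size + (q + q′) * size
      exponents = trans (sym (*-distribˡ-+ (3 * q) (hits f) (misses f)))
                    (trans (cong (3 * q *_) (hits+misses f)) (split q′ size))
        where
        split : ∀ q′ m → 3 * suc q′ * m ≡ suc (suc q′) * m + (suc q′ + q′) * m
        split = solve-∀

    numHeavy-chernoff : numHeavy w i₀ c * (3 * K) ^ size ≤ numOutcomes k n col * (α + 2 * β) ^ size
    numHeavy-chernoff = begin
      numHeavy w i₀ c * (3 * K) ^ size
        ≡⟨ cong (numHeavy w i₀ c *_) (trans (^-distribʳ-* 3 K size) (*-comm (3 ^ size) (K ^ size))) ⟩
      numHeavy w i₀ c * (K ^ size * 3 ^ size)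
        ≡⟨ sym (*-assoc (numHeavy w i₀ c) (K ^ size) (3 ^ size)) ⟩
      numHeavy w i₀ c * K ^ size * 3 ^ size
        ≤⟨ *-monoˡ-≤ (3 ^ size) (countB-*-≤-sumOver _ (K ^ size) weight (allInner k n) markov) ⟩
      sumOver weight (allInner k n) * 3 ^ size
        ≡⟨ exponential-moment ⟩
      numOutcomes k n col * (α + 2 * β) ^ size ∎
      where
      open ≤-Reasoning
      weight : Inner k n → ℕ
      weight f = ⟦ validInner k n col f ⟧ * (α ^ hits f * β ^ misses f)
      markov : ∀ f → T (validInner k n col f ∧ heavy f w i₀ c) → K ^ size ≤ weight f
      markov f vh with validInner k n col f | T-∧⁻ (validInner k n col f) vh
      ... | true | _ , h = ≤-trans (heavy⇒K^size≤ f h) (m≤m+n _ 0)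

  numHeavy-small : ∀ C → (∀ m → suc m ≡ n → C * n * (α + 2 * β) ^ m ≤ (3 * K) ^ m) →
                   ∀ w i c → C * n * numHeavy w i c ≤ numOutcomes k n col
  numHeavy-small C growth w i c with T? (fullĜ w)
  ... | no ¬full = subst (_≤ numOutcomes k n col) (sym (trans (cong (C * n *_) no-bad) (*-zeroʳ (C * n)))) z≤n
    where
    no-bad : numHeavy w i c ≡ 0
    no-bad = countB-none _ (allInner k n) λ f vh → ¬full (proj₁ (T-∧⁻ (fullĜ w) (proj₂ (T-∧⁻ (validInner k n col f) vh))))
  ... | yes full = *-cancelʳ-≤ _ _ ((3 * K) ^ size) {{m^n≢0 (3 * K) size {{3K≢0}}}} (begin
    C * n * numHeavy w i c * (3 * K) ^ size             ≡⟨ *-assoc (C * n) (numHeavy w i c) _ ⟩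
    C * n * (numHeavy w i c * (3 * K) ^ size)           ≤⟨ *-monoʳ-≤ (C * n) (numHeavy-chernoff w i c full) ⟩
    C * n * (numOutcomes k n col * (α + 2 * β) ^ size)  ≡⟨ x*[y*z]≡y*[x*z] (C * n) (numOutcomes k n col) _ ⟩
    numOutcomes k n col * (C * n * (α + 2 * β) ^ size)  ≤⟨ *-monoʳ-≤ (numOutcomes k n col) (growth size star-size) ⟩
    numOutcomes k n col * (3 * K) ^ size                ∎)
    where
    open ≤-Reasoning
    open Moments k n col
    open Star w i
    open ExponentialMoment c α β star (star-free full)
    x*[y*z]≡y*[x*z] : ∀ x y z → x * (y * z) ≡ y * (x * z)
    x*[y*z]≡y*[x*z] = solve-∀

  ∑ᵛᶜ : (Fin k → Fin n → Colour → ℕ) → ℕ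
  ∑ᵛᶜ g = ∑[ w < k ] ∑[ i < n ] ∑[ c < 3 ] g w i c

  light⇒sparse : ∀ f → (∀ w i c → ¬ T (heavy f w i c)) → B.LowInnerDegrees f p q
  light⇒sparse f light w i c full = ≤ᵇ⇒≤ _ _ (T-¬not (λ heavy → light w i c (T-∧⁺ full heavy)))

  valid⇒good-or-heavy : ∀ f → ⟦ validInner k n col f ⟧ ≤
    ⟦ validInner k n col f ∧ allGoodBounded (Gn k n col f) p q (n * k) ⟧ + ∑ᵛᶜ (λ w i c → ⟦ validInner k n col f ∧ heavy f w i c ⟧)
  valid⇒good-or-heavy f with validInner k n col f in valid | ∑ᵛᶜ (λ w i c → ⟦ heavy f w i c ⟧) ≟ 0
  ... | false | _ = z≤n
  ... | true | no some-heavy = ≤-trans (n≢0⇒n>0 some-heavy) (m≤n+m _ _)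
  ... | true | yes none-heavy = ≤-trans (T⇒⟦⟧>0 good) (m≤m+n _ _)
    where
    light : ∀ w i c → ¬ T (heavy f w i c)
    light w i c h = <⇒≱ (T⇒⟦⟧>0 h) (≤-trans (≤-trans (≤-∑ (λ c → ⟦ heavy f w i c ⟧) c)
                                              (≤-trans (≤-∑ (λ i → ∑[ c < 3 ] ⟦ heavy f w i c ⟧) i)
                                                       (≤-∑ (λ w → ∑[ i < n ] ∑[ c < 3 ] ⟦ heavy f w i c ⟧) w)))
                                      (≤-reflexive none-heavy))
    good : T (allGoodBounded (Gn k n col f) p q (n * k))
    good = B.allGoodBounded-holds f {p} {q} k≥3 col-comm (subst T (sym valid) _) (light⇒sparse f light) few

  numOutcomes≤numGood+∑numHeavy : numOutcomes k n col ≤ numGood k n col p q + ∑ᵛᶜ numHeavy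
  numOutcomes≤numGood+∑numHeavy = begin
    numOutcomes k n col                                   ≡⟨ countB≡sumOver (validInner k n col) (allInner k n) ⟩
    sumOver (λ f → ⟦ validInner k n col f ⟧) (allInner k n) ≤⟨ sumOver-mono (allInner k n) valid⇒good-or-heavy ⟩
    sumOver (λ f → ⟦ good f ⟧ + ∑ᵛᶜ (bad f)) (allInner k n) ≡⟨ sumOver-+ (λ f → ⟦ good f ⟧) (λ f → ∑ᵛᶜ (bad f)) (allInner k n) ⟩
    sumOver (λ f → ⟦ good f ⟧) (allInner k n) + sumOver (λ f → ∑ᵛᶜ (bad f)) (allInner k n)
      ≡⟨ cong₂ _+_ (sym (countB≡sumOver good (allInner k n))) interchange ⟩
    numGood k n col p q + ∑ᵛᶜ numHeavy                          ∎
    where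
    open ≤-Reasoning
    good : Inner k n → Bool
    good f = validInner k n col f ∧ allGoodBounded (Gn k n col f) p q (n * k)
    bad : Inner k n → Fin k → Fin n → Colour → ℕ
    bad f w i c = ⟦ validInner k n col f ∧ heavy f w i c ⟧
    interchange : sumOver (λ f → ∑ᵛᶜ (bad f)) (allInner k n) ≡ ∑ᵛᶜ numHeavy
    interchange =
      trans (sumOver-∑ (λ f w → ∑[ i < n ] ∑[ c < 3 ] bad f w i c) (allInner k n)) (sum-cong-≗ λ w →
      trans (sumOver-∑ (λ f i → ∑[ c < 3 ] bad f w i c) (allInner k n)) (sum-cong-≗ λ i →
      trans (sumOver-∑ (λ f c → bad f w i c) (allInner k n)) (sum-cong-≗ λ c →
      sym (countB≡sumOver (λ f → validInner k n col f ∧ heavy f w i c) (allInner k n)))))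

  d*∑numHeavy≤numOutcomes : ∀ d → 1 ≤ n → (∀ w i c → 3 * d * k * n * numHeavy w i c ≤ numOutcomes k n col) →
                            d * ∑ᵛᶜ numHeavy ≤ numOutcomes k n col
  d*∑numHeavy≤numOutcomes d n≥1 rare = *-cancelˡ-≤ (3 * k * n) {{3kn≢0}} (begin
    3 * k * n * (d * ∑ᵛᶜ numHeavy)                   ≡⟨ regroup k n d (∑ᵛᶜ numHeavy) ⟩
    3 * d * k * n * ∑ᵛᶜ numHeavy                     ≡⟨ ∑ᵛᶜ-*ˡ (3 * d * k * n) numHeavy ⟩
    ∑ᵛᶜ (λ w i c → 3 * d * k * n * numHeavy w i c)  ≤⟨ ∑-mono-≤ (λ w → ∑-mono-≤ (λ i → ∑-mono-≤ (λ c → rare w i c))) ⟩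
    ∑ᵛᶜ (λ _ _ _ → numOutcomes k n col)              ≡⟨ ∑ᵛᶜ-const (numOutcomes k n col) ⟩
    3 * k * n * numOutcomes k n col                  ∎)
    where
    open ≤-Reasoning
    3kn≢0 : NonZero (3 * k * n)
    3kn≢0 = >-nonZero (*-mono-≤ (*-mono-≤ {1} {3} (s≤s z≤n) (≤-trans (s≤s z≤n) k≥3)) n≥1)
    regroup : ∀ k n d S → 3 * k * n * (d * S) ≡ 3 * d * k * n * S
    regroup = solve-∀
    ∑ᵛᶜ-*ˡ : ∀ a g → a * ∑ᵛᶜ g ≡ ∑ᵛᶜ (λ w i c → a * g w i c)
    ∑ᵛᶜ-*ˡ a g = trans (*-distribˡ-sum a (λ w → ∑[ i < n ] ∑[ c < 3 ] g w i c)) (sum-cong-≗ λ w →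
                 trans (*-distribˡ-sum a (λ i → ∑[ c < 3 ] g w i c)) (sum-cong-≗ λ i → *-distribˡ-sum a (g w i)))
    ∑ᵛᶜ-const : ∀ a → ∑ᵛᶜ (λ _ _ _ → a) ≡ 3 * k * n * a
    ∑ᵛᶜ-const a = trans (sum-cong-≗ {k} λ w → trans (sum-cong-≗ {n} λ i → ∑-const 3 a) (∑-const n (3 * a)))
                        (trans (∑-const k (n * (3 * a))) (collect k n a))
      where
      collect : ∀ k n a → k * (n * (3 * a)) ≡ 3 * k * n * a
      collect = solve-∀

  failures-rare : ∀ d → 1 ≤ n → (∀ m → suc m ≡ n → 3 * d * k * n * (α + 2 * β) ^ m ≤ (3 * K) ^ m) →
                  d * (numOutcomes k n col ∸ numGood k n col p q) ≤ numOutcomes k n col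
  failures-rare d n≥1 grows = begin
    d * (numOutcomes k n col ∸ numGood k n col p q) ≤⟨ *-monoʳ-≤ d (m≤n+o⇒m∸n≤o _ _ numOutcomes≤numGood+∑numHeavy) ⟩
    d * ∑ᵛᶜ numHeavy                                 ≤⟨ d*∑numHeavy≤numOutcomes d n≥1 (numHeavy-small (3 * d * k) grows) ⟩
    numOutcomes k n col                              ∎
    where open ≤-Reasoning

lemma2p2 : (k : ℕ) → 3 ≤ k → (col : Fin k → Fin k → Colour)
    → (∀ u v → col u v ≡ col v u)
    → (∀ (c : Colour) (x y z : Fin k) → x ≢ y → x ≢ z → y ≢ z
    → 3 * domCount (hatG k col) (x ∷ y ∷ z ∷ []) c < 2 * k)
    → (p q : ℕ) → 0 < p → 0 < q
    → (d : ℕ) → 0 < d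
    → ∃ λ (N : ℕ) → ∀ (n : ℕ) → N ≤ n
    → d * (numOutcomes k n col ∸ numGood k n col p q) ≤ numOutcomes k n col
lemma2p2 _ _ _ _ _ _ zero _ () _ _
lemma2p2 k k≥3 col col-comm few p (suc q′) p>0 _ d _ =
  let open ChernoffWeights q′
      N , grows = C*[1+m]*Q^m≤[1+Q]^m-eventually (α + 2 * β) (3 * d * k) α+2β≥1
  in suc N , λ n N<n → Counting.failures-rare k k≥3 col col-comm few p q′ p>0 n d (≤-trans (s≤s z≤n) N<n) λ m 1+m≡n →
       ≤-trans (subst (λ n → 3 * d * k * n * (α + 2 * β) ^ m ≤ suc (α + 2 * β) ^ m) 1+m≡n
                      (grows m (≤-pred (subst (suc N ≤_) (sym 1+m≡n) N<n))))
               (^-monoˡ-≤ m (chernoff-weights q′))
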